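{- For integers $n\ge r\ge 0$, \[ \sum_{R\in\mathrm{RAT}(n,r)}\alpha^{\mathrm{frow}(R)}\beta^{\mathrm{fcol}(R)}z_1^{a_1(R)}\cdots z_r^{a_r(R)}=\binom{n}{r}(\alpha+\beta+z_1+\cdots+z_r)_{n-r}, \] where $(x)_m=x(x+1)\cdots(x+m-1)$ (and $(x)_0=1$).
   Context: Rhombic diagrams. For a word $w=w_1\cdots w_n\in\{0,1,2\}^n$, the rhombic diagram $\Gamma_w$ is the region bounded by two lattice paths from a common starting point: the southeast border, obtained by reading $w$ left to right and taking a unit step south for each $2$, southwest (vector $(-1,-1)$) for each $1$, west for each $0$; and the northwest border, consisting of (number of $0$'s) steps west, then (number of $1$'s) steps southwest, then (number of $2$'s) steps south. It is tiled by unit squares, tall rhombi (two vertical, two diagonal sides) and short rhombi (two horizontal, two diagonal sides) via the maximal tiling: if no $i$ has $w_i>w_{i+1}$ there is nothing to tile; otherwise take the smallest such $i$, tile the region of the word obtained by swapping $w_i,w_{i+1}$, and fill the remaining tile by a tall rhombus, square or short rhombus according as $(w_i,w_{i+1})=(2,1),(2,0),(1,0)$. Label the southeast border edges $1,\dots,n$ from northeast to southwest. A strip is a maximal sequence of tiles connected through parallel edges; each border edge starts a strip (possibly empty) ending at the northwest border. Strips starting at vertical edges are rows, at horizontal edges columns, at diagonal edges diagonal strips. A rhombic alternative tableau (RAT) of shape $w$ is a filling of some tiles with up-arrows (only in tiles belonging to a column) and left-arrows (only in tiles belonging to a row) such that no arrow lies in a cell pointed to by another arrow, where a left-arrow points to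 all other cells of its row to its west (toward the northwest border) and an up-arrow to all other cells of its column to its north. $\mathrm{RAT}(n,r)$ is the set of RAT whose shape has length $n$ with exactly $r$ letters equal to $1$. $\mathrm{frow}(R)$ is the number of rows with no left-arrow, $\mathrm{fcol}(R)$ the number of columns with no up-arrow, and $a_i(R)$ is the number of arrows in the cells of the $i$-th topmost diagonal strip (the diagonal strip with the $i$-th smallest label), $1\le i\le r$. -}

module Defs where

open import Level using (Level)
open import Data.Nat using (ℕ; zero; suc; _∸_; _<ᵇ_; _≡ᵇ_)
import Data.Nat as N
open import Data.Nat.Combinatorics using (_C_)
open import Data.Bool using (Bool; true; false; if_then_else_; _∧_; _∨_; not)
open import Data.List using (List; []; _∷_; length; map; filter; concatMap; zip; applyUpTo)
open import Data.Bool.ListAction using (all; any)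
open import Data.Product using (_×_; _,_; proj₁; proj₂)
open import Data.Maybe using (Maybe; just; nothing)
open import Data.Vec using (Vec; toList)
open import Algebra.Bundles using (CommutativeSemiring)

data Letter : Set where
  L0 L1 L2 : Letter

_>ᴸ_ : Letter → Letter → Bool
L2 >ᴸ L1 = true
L2 >ᴸ L0 = true
L1 >ᴸ L0 = true
_  >ᴸ _  = false

_=ᴸ_ : Letter → Letter → Bool
L0 =ᴸ L0 = true
L1 =ᴸ L1 = true
L2 =ᴸ L2 = true
_  =ᴸ _  = false

words : ℕ → List (List Letter)
words zero    = [] ∷ []
words (suc n) = concatMap (λ w → (L0 ∷ w) ∷ (L1 ∷ w) ∷ (L2 ∷ w) ∷ []) (words n)

countL : Letter → List Letter → ℕ
countL c []      = 0
countL c (a ∷ w) = if a =ᴸ c then suc (countL c w) else countL c w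

-- a letter together with its label (= position 1..n, i.e. the label of
-- the corresponding south-east border edge, numbered from north-east)
Labelled : Set
Labelled = ℕ × Letter

labelW : List Letter → List Labelled
labelW w = zip (applyUpTo suc (length w)) w

-- A tile is created by swapping the adjacent letters (w_i, w_{i+1}) with
-- w_i > w_{i+1}; we record the labels and letters of the two swapped
-- letters (left one = larger letter).  Type (2,1): tall rhombus,
-- (2,0): square, (1,0): short rhombus.  The tile lies in the strip of
-- each of its two labels.

record Tile : Set where
  constructor tile
  field
    lab₁ : ℕ
    let₁ : Letter
    lab₂ : ℕ
    let₂ : Letter
open Tile public

step : List Labelled → Maybe (Tile × List Labelled)
stepFrom : Labelled → List Labelled → Maybe (Tile × List Labelled)
step []       = nothing
step (x ∷ xs) = stepFrom x xs
stepFrom x []       = nothing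
stepFrom x (y ∷ rest) with proj₂ x >ᴸ proj₂ y
... | true  = just (tile (proj₁ x) (proj₂ x) (proj₁ y) (proj₂ y) , y ∷ x ∷ rest)
... | false with stepFrom y rest
...   | nothing        = nothing
...   | just (t , w')  = just (t , x ∷ w')

-- iterate with fuel; tiles listed in the order they are produced, i.e.
-- the first tile is adjacent to the south-east border.
tilesF : ℕ → List Labelled → List Tile
tilesF zero    w = []
tilesF (suc f) w with step w
... | nothing       = []
... | just (t , w') = t ∷ tilesF f w'

-- the maximal tiling of Γ_w (fuel n*n exceeds the number of inversions)
maximalTiling : List Letter → List Tile
maximalTiling w = tilesF (length w N.* length w) (labelW w)

inStrip : ℕ → Tile → Bool
inStrip i t = (lab₁ t ≡ᵇ i) ∨ (lab₂ t ≡ᵇ i)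

data Arrow : Set where
  none up left : Arrow

isArrow : Arrow → Bool
isArrow none = false
isArrow _    = true

isUp : Arrow → Bool
isUp up = true
isUp _  = false

isLeft : Arrow → Bool
isLeft left = true
isLeft _    = false

fillings : ℕ → List (List Arrow)
fillings zero    = [] ∷ []
fillings (suc m) = concatMap (λ f → (none ∷ f) ∷ (up ∷ f) ∷ (left ∷ f) ∷ []) (fillings m)

-- a placed tile: (position along the production order, tile, arrow)
Placed : Set
Placed = ℕ × Tile × Arrow

place : List Tile → List Arrow → List Placed
place ts as = zip (applyUpTo (λ k → k) (length ts)) (zip ts as)

-- up-arrows only in tiles of a column (let₂ = 0),
-- left-arrows only in tiles of a row (let₁ = 2)
allowed : Tile → Arrow → Bool
allowed t none = true
allowed t up   = let₂ t =ᴸ L0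
allowed t left = let₁ t =ᴸ L2

-- p points to q: q is another cell of p's row (resp. column) lying
-- further from the south-east border, i.e. west (resp. north) of p
pointsTo : Placed → Placed → Bool
pointsTo (k , t , none) q            = false
pointsTo (k , t , up)   (k' , t' , _) = (k <ᵇ k') ∧ inStrip (lab₂ t) t'
pointsTo (k , t , left) (k' , t' , _) = (k <ᵇ k') ∧ inStrip (lab₁ t) t'

validPlaced : List Placed → Bool
validPlaced ps =
  all (λ p → allowed (proj₁ (proj₂ p)) (proj₂ (proj₂ p))) ps ∧
  all (λ p → all (λ q → not (isArrow (proj₂ (proj₂ q)) ∧ pointsTo p q)) ps) ps

RAT : Set
RAT = List Letter × List Arrow

placedOf : RAT → List Placed
placedOf (w , f) = place (maximalTiling w) f

isRAT : RAT → Bool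
isRAT (w , f) = (length f ≡ᵇ length (maximalTiling w)) ∧ validPlaced (placedOf (w , f))

RATs : ℕ → ℕ → List RAT
RATs n r =
  concatMap (λ w → filter (λ R → isRAT R Data.Bool.≟ true)
                     (map (λ f → (w , f)) (fillings (length (maximalTiling w)))))
            (filter (λ w → countL L1 w Data.Nat.≟ r) (words n))

countB : {A : Set} → (A → Bool) → List A → ℕ
countB p []      = 0
countB p (x ∷ l) = if p x then suc (countB p l) else countB p l

frow : RAT → ℕ
frow (w , f) =
  countB (λ x → (proj₂ x =ᴸ L2) ∧
                not (any (λ p → isLeft (proj₂ (proj₂ p)) ∧ inStrip (proj₁ x) (proj₁ (proj₂ p)))
                         (placedOf (w , f))))
         (labelW w)

fcol : RAT → ℕ
fcol (w , f) =
  countB (λ x → (proj₂ x =ᴸ L0) ∧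
                not (any (λ p → isUp (proj₂ (proj₂ p)) ∧ inStrip (proj₁ x) (proj₁ (proj₂ p)))
                         (placedOf (w , f))))
         (labelW w)

-- the list (a_1(R), ..., a_r(R)): arrows in the diagonal strips,
-- ordered by increasing label
aStats : RAT → List ℕ
aStats (w , f) =
  map (λ x → countB (λ p → isArrow (proj₂ (proj₂ p)) ∧ inStrip (proj₁ x) (proj₁ (proj₂ p)))
                    (placedOf (w , f)))
      (filter (λ x → proj₂ x =ᴸ L1 Data.Bool.≟ true) (labelW w))

module Gen {c ℓ : Level} (S : CommutativeSemiring c ℓ) where
  open CommutativeSemiring S

  pow : Carrier → ℕ → Carrier
  pow x zero    = 1#
  pow x (suc k) = x * pow x k

  natS : ℕ → Carrier
  natS zero    = 0#
  natS (suc k) = 1# + natS k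

  rising : Carrier → ℕ → Carrier
  rising x zero    = 1#
  rising x (suc m) = rising x m * (x + natS m)

  sumS : List Carrier → Carrier
  sumS []      = 0#
  sumS (x ∷ l) = x + sumS l

  zMonomial : List Carrier → List ℕ → Carrier
  zMonomial (z ∷ zs) (a ∷ as) = pow z a * zMonomial zs as
  zMonomial _        _        = 1#

  weight : Carrier → Carrier → List Carrier → RAT → Carrier
  weight α β zs R = pow α (frow R) * pow β (fcol R) * zMonomial zs (aStats R)

  LHS : (n r : ℕ) → Carrier → Carrier → Vec Carrier r → Carrier
  LHS n r α β z = sumS (map (weight α β (toList z)) (RATs n r))

  RHS : (n r : ℕ) → Carrier → Carrier → Vec Carrier r → Carrier
  RHS n r α β z = natS (n C r) * rising (α + β + sumS (toList z)) (n ∸ r)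

{-# OPTIONS --safe #-}
-- Let Z(x) be the generating function of the fillings of the maximal tiling of a labelled word x.
-- The first tile is created at the first descent f g of x; it is either empty or carries an
-- arrow, and an arrow deletes its row or column from the rest of the tableau. This gives a
-- Matrix-Ansatz relation Z(u f g v) = Z(u g f v) + Σ k Z(u d v), namely
-- 2 1 ↦ 1 2 + z·1,  2 0 ↦ 0 2 + 2 + 0,  1 0 ↦ 0 1 + z·1.
-- By induction on the number of inversions the relation holds at every descent, not only the
-- first; the one overlap to check is 2 1 0. So a 0 moves to the front (a factor β, plus the
-- weights z of the 1s it passes) and a 2 to the end (a factor α, plus the z of each 1 and 1 for
-- each 0 or 2 it passes). Summing over all words with the 1s at fixed positions, the i-th last
-- position of a 0 or 2 contributes the factor α + β + z₁ + ⋯ + z_r + (i − 1). There are C(n, r)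
-- ways to place the 1s.
module Submission where

open import Defs
open import Level using (Level)
open import Data.Nat using (ℕ; zero; suc; _∸_; _≤_; _<_; z≤n; s≤s; _≡ᵇ_; _<ᵇ_)
import Data.Nat as Nat
import Data.Nat.Properties as ℕ
open import Data.Nat.Induction using (<-wellFounded)
open import Data.Bool using (Bool; true; false; if_then_else_; _∧_; _∨_; not; T)
open import Data.Bool.Properties
  using (∨-assoc; ∧-identityʳ; ∧-zeroʳ; ∨-identityʳ; ∨-zeroʳ; ∨-commutativeMonoid; ∧-commutativeMonoid)
open import Data.Bool.ListAction using (all; any)
open import Data.List using (List; []; _∷_; _++_; [_]; length; map; filter; concatMap; zip; applyUpTo)
open import Data.List.Relation.Unary.All as All using (All; []; _∷_)
import Data.List.Relation.Unary.All.Properties as All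
open import Data.List.Relation.Unary.AllPairs as AllPairs using (AllPairs; []; _∷_)
import Data.List.Relation.Unary.AllPairs.Properties as AllPairs
import Data.List.Properties as List
open import Data.List.Relation.Binary.Sublist.Propositional using (_⊆_; []; _∷_; _∷ʳ_; ⊆-refl)
open import Data.List.Relation.Binary.Sublist.Propositional.Properties as Sublist using (++⁺; All-resp-⊆)
open import Data.List.Relation.Binary.Permutation.Propositional as ↭ using (_↭_)
open import Data.List.Relation.Binary.Permutation.Propositional.Properties as ↭ using (++⁺ˡ; shift; All-resp-↭)
open import Data.Product using (_×_; _,_; proj₁; proj₂)
open import Data.Nat.Combinatorics using (_C_; nCk+nC[k+1]≡[n+1]C[k+1])
open import Data.Sum using (_⊎_; inj₁; inj₂)
open import Data.Empty using (⊥-elim)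
open import Data.Maybe using (just; nothing)
open import Relation.Nullary using (Dec; does)
open import Data.Vec using (Vec; toList)
open import Data.Vec.Properties using (length-toList)
open import Algebra.Bundles using (CommutativeSemiring; CommutativeMonoid)
open import Function using (_∘_)
import Induction.WellFounded as WF
import Relation.Binary.Construct.On as On
import Algebra.Properties.CommutativeSemigroup as CommutativeSemigroupProperties
open import Relation.Binary.PropositionalEquality
  using (_≡_; refl; sym; trans; cong; cong₂; subst; subst₂; _≢_; module ≡-Reasoning)

private
  variable
    A B : Set

  module ∧-Props  = CommutativeSemigroupProperties (CommutativeMonoid.commutativeSemigroup ∧-commutativeMonoid)
  module ∨-Props  = CommutativeSemigroupProperties (CommutativeMonoid.commutativeSemigroup ∨-commutativeMonoid)
  module ℕ+-Props = CommutativeSemigroupProperties ℕ.+-commutativeSemigroup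

true≢false : true ≡ false → A
true≢false ()

∨-false : ∀ a b → (a ∨ b) ≡ false → (a ≡ false) × (b ≡ false)
∨-false false false refl = refl , refl

∧-not-∨ : ∀ c i h → (c ∧ not (i ∨ h)) ≡ (c ∧ not h) ∧ not i
∧-not-∨ false i     h     = refl
∧-not-∨ true  false h     = sym (∧-identityʳ (not h))
∧-not-∨ true  true  h     = sym (∧-zeroʳ (not h))

not-∧-∨ : ∀ x i b → not (x ∧ i) ∧ not (x ∧ b) ≡ not (x ∧ (i ∨ b))
not-∧-∨ false _     _ = refl
not-∧-∨ true  true  _ = refl
not-∧-∨ true  false _ = refl

T⇒≡true : ∀ {b} → T b → b ≡ true
T⇒≡true {true} _ = refl

does-≟-true : ∀ b → does (b Data.Bool.≟ true) ≡ b
does-≟-true true  = refl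
does-≟-true false = refl

≡ᵇ-refl : ∀ n → (n ≡ᵇ n) ≡ true
≡ᵇ-refl zero    = refl
≡ᵇ-refl (suc n) = ≡ᵇ-refl n

≡ᵇ-sym : ∀ m n → (m ≡ᵇ n) ≡ (n ≡ᵇ m)
≡ᵇ-sym zero    zero    = refl
≡ᵇ-sym zero    (suc n) = refl
≡ᵇ-sym (suc m) zero    = refl
≡ᵇ-sym (suc m) (suc n) = ≡ᵇ-sym m n

≡ᵇ-true⇒≡ : ∀ m n → (m ≡ᵇ n) ≡ true → m ≡ n
≡ᵇ-true⇒≡ m n h = ℕ.≡ᵇ⇒≡ m n (subst T (sym h) _)

≢⇒≡ᵇ-false : ∀ m n → m ≢ n → (m ≡ᵇ n) ≡ false
≢⇒≡ᵇ-false m n m≢n with m ≡ᵇ n in eq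
... | true  = ⊥-elim (m≢n (≡ᵇ-true⇒≡ m n eq))
... | false = refl

<ᵇ-irrefl : ∀ k → (k <ᵇ k) ≡ false
<ᵇ-irrefl zero    = refl
<ᵇ-irrefl (suc k) = <ᵇ-irrefl k

<⇒<ᵇ-true : ∀ {m n} → m < n → (m <ᵇ n) ≡ true
<⇒<ᵇ-true m<n = T⇒≡true (ℕ.<⇒<ᵇ m<n)

<⇒>ᵇ-false : ∀ {m n} → m < n → (n <ᵇ m) ≡ false
<⇒>ᵇ-false {m} {n} m<n with n <ᵇ m in n<m
... | true  = ⊥-elim (ℕ.<-asym m<n (ℕ.<ᵇ⇒< n m (subst T (sym n<m) _)))
... | false = refl

countB-↭ : ∀ (P : A → Bool) {x y} → x ↭ y → countB P x ≡ countB P y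
countB-↭ P ↭.refl = refl
countB-↭ P (↭.prep a x↭y) = cong (λ k → if P a then suc k else k) (countB-↭ P x↭y)
countB-↭ P (↭.swap a b x↭y) with P a | P b
... | true  | true  = cong (suc ∘ suc) (countB-↭ P x↭y)
... | true  | false = cong suc (countB-↭ P x↭y)
... | false | true  = cong suc (countB-↭ P x↭y)
... | false | false = countB-↭ P x↭y
countB-↭ P (↭.trans x↭y y↭z) = trans (countB-↭ P x↭y) (countB-↭ P y↭z)

countB-delete : ∀ (P : A → Bool) p a q → countB P (p ++ q) ≤ countB P (p ++ a ∷ q)
countB-delete P [] a q with P a
... | true  = ℕ.n≤1+n _
... | false = ℕ.≤-refl
countB-delete P (e ∷ p) a q with P e
... | true  = s≤s (countB-delete P p a q)
... | false = countB-delete P p a q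

countB≤length : ∀ (P : A → Bool) x → countB P x ≤ length x
countB≤length P [] = z≤n
countB≤length P (e ∷ x) with P e
... | true  = s≤s (countB≤length P x)
... | false = ℕ.m≤n⇒m≤1+n (countB≤length P x)

countB-map : ∀ (P : B → Bool) (f : A → B) x → countB P (map f x) ≡ countB (λ e → P (f e)) x
countB-map P f []      = refl
countB-map P f (e ∷ x) rewrite countB-map P f x = refl

countB-congᴬ : ∀ {P Q : A → Bool} {x} → All (λ e → P e ≡ Q e) x → countB P x ≡ countB Q x
countB-congᴬ {x = []}    []       = refl
countB-congᴬ {x = e ∷ x} (eq ∷ r) rewrite eq = cong (λ k → if _ then suc k else k) (countB-congᴬ r)

↭-swapAt : ∀ p (a b : A) q → p ++ a ∷ b ∷ q ↭ p ++ b ∷ a ∷ q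
↭-swapAt p a b q = ++⁺ˡ p (↭.swap a b ↭.refl)

AllPairs-resp-↭ : ∀ {R : A → A → Set} → (∀ {a b} → R a b → R b a) →
  ∀ {x y} → x ↭ y → AllPairs R x → AllPairs R y
AllPairs-resp-↭ R-sym ↭.refl               r                        = r
AllPairs-resp-↭ R-sym (↭.prep a x↭y)       (ra ∷ r)                 =
  All-resp-↭ x↭y ra ∷ AllPairs-resp-↭ R-sym x↭y r
AllPairs-resp-↭ R-sym (↭.swap a b x↭y)     ((rab ∷ ra) ∷ rb ∷ r)    =
  (R-sym rab ∷ All-resp-↭ x↭y rb) ∷ All-resp-↭ x↭y ra ∷ AllPairs-resp-↭ R-sym x↭y r
AllPairs-resp-↭ R-sym (↭.trans x↭y y↭z)    r                        =
  AllPairs-resp-↭ R-sym y↭z (AllPairs-resp-↭ R-sym x↭y r)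

AllPairs-resp-⊆ : ∀ {R : A → A → Set} {x y} → x ⊆ y → AllPairs R y → AllPairs R x
AllPairs-resp-⊆ []          []       = []
AllPairs-resp-⊆ (_ ∷ʳ x⊆y)  (_ ∷ r)  = AllPairs-resp-⊆ x⊆y r
AllPairs-resp-⊆ (refl ∷ x⊆y) (ra ∷ r) = All-resp-⊆ x⊆y ra ∷ AllPairs-resp-⊆ x⊆y r

AllPairs-++⁻ʳ : ∀ {R : A → A → Set} p {y} → AllPairs R (p ++ y) → AllPairs R y
AllPairs-++⁻ʳ []      r       = r
AllPairs-++⁻ʳ (e ∷ p) (_ ∷ r) = AllPairs-++⁻ʳ p r

⊆-dropAt : ∀ p (a : A) q → p ++ q ⊆ p ++ a ∷ q
⊆-dropAt p a q = ++⁺ ⊆-refl (a ∷ʳ ⊆-refl)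

⊆-dropSecond : ∀ p (a b : A) q → p ++ a ∷ q ⊆ p ++ a ∷ b ∷ q
⊆-dropSecond p a b q = ++⁺ ⊆-refl (refl ∷ b ∷ʳ ⊆-refl)

all-congᴬ : ∀ {P Q : A → Bool} {L} → All (λ a → P a ≡ Q a) L → all P L ≡ all Q L
all-congᴬ []         = refl
all-congᴬ (eq ∷ eqs) = cong₂ _∧_ eq (all-congᴬ eqs)

all-true : ∀ {P : A → Bool} L → (∀ a → P a ≡ true) → all P L ≡ true
all-true []      _     = refl
all-true (a ∷ L) P≡true rewrite P≡true a = all-true L P≡true

all-∧ : ∀ (P Q : A → Bool) L → all P L ∧ all Q L ≡ all (λ a → P a ∧ Q a) L
all-∧ P Q []      = refl
all-∧ P Q (a ∷ L) = trans (∧-Props.interchange (P a) (all P L) (Q a) (all Q L)) (cong ((P a ∧ Q a) ∧_) (all-∧ P Q L))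

label : Labelled → ℕ
label = proj₁

letter : Labelled → Letter
letter = proj₂

_≻_ : Labelled → Labelled → Bool
e ≻ f = letter e >ᴸ letter f

tileOf : Labelled → Labelled → Tile
tileOf e f = tile (label e) (letter e) (label f) (letter f)

≯-trans : ∀ a b c → (a >ᴸ b) ≡ false → (b >ᴸ c) ≡ false → (a >ᴸ c) ≡ false
≯-trans L0 _  _  _  _  = refl
≯-trans L1 L1 _  _  q  = q
≯-trans L1 L2 L2 _  _  = refl
≯-trans L2 L2 _  _  q  = q
≯-trans L1 L0 _  () _
≯-trans L1 L2 L0 _  ()
≯-trans L1 L2 L1 _  ()
≯-trans L2 L0 _  () _
≯-trans L2 L1 _  () _

>ᴸ-asym : ∀ a b → (a >ᴸ b) ≡ true → (b >ᴸ a) ≡ false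
>ᴸ-asym L1 L0 _ = refl
>ᴸ-asym L2 L0 _ = refl
>ᴸ-asym L2 L1 _ = refl
>ᴸ-asym L0 _  ()
>ᴸ-asym L1 L1 ()
>ᴸ-asym L1 L2 ()
>ᴸ-asym L2 L2 ()

Sorted : List Labelled → Set
Sorted = AllPairs (λ e f → (e ≻ f) ≡ false)

sorted-∷ : ∀ e f y → (e ≻ f) ≡ false → Sorted (f ∷ y) → Sorted (e ∷ f ∷ y)
sorted-∷ e f y e≯f (f≯y ∷ s) =
  (e≯f ∷ All.map (λ {g} → ≯-trans (letter e) (letter f) (letter g) e≯f) f≯y) ∷ f≯y ∷ s

stepFrom-swap : ∀ e f q → (e ≻ f) ≡ true → stepFrom e (f ∷ q) ≡ just (tileOf e f , f ∷ e ∷ q)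
stepFrom-swap e f q e≻f rewrite e≻f = refl

stepFrom-descent : ∀ e p f g q → Sorted (e ∷ p ++ [ f ]) → (f ≻ g) ≡ true →
  stepFrom e (p ++ f ∷ g ∷ q) ≡ just (tileOf f g , e ∷ p ++ g ∷ f ∷ q)
stepFrom-descent e []      f g q ((e≯f ∷ []) ∷ _) f≻g rewrite e≯f | stepFrom-swap f g q f≻g = refl
stepFrom-descent e (k ∷ p) f g q ((e≯k ∷ _) ∷ s) f≻g rewrite e≯k | stepFrom-descent k p f g q s f≻g = refl

step-descent : ∀ p f g q → Sorted (p ++ [ f ]) → (f ≻ g) ≡ true →
  step (p ++ f ∷ g ∷ q) ≡ just (tileOf f g , p ++ g ∷ f ∷ q)
step-descent []      f g q _ f≻g = stepFrom-swap f g q f≻g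
step-descent (e ∷ p) f g q s f≻g = stepFrom-descent e p f g q s f≻g

stepFrom-sorted : ∀ e x → Sorted (e ∷ x) → stepFrom e x ≡ nothing
stepFrom-sorted e []      _ = refl
stepFrom-sorted e (f ∷ x) ((e≯f ∷ _) ∷ s) rewrite e≯f | stepFrom-sorted f x s = refl

step-sorted : ∀ x → Sorted x → step x ≡ nothing
step-sorted []      _ = refl
step-sorted (e ∷ x) s = stepFrom-sorted e x s

data FirstDescent (x : List Labelled) : Set where
  sorted  : Sorted x → FirstDescent x
  descent : ∀ p f g q → x ≡ p ++ f ∷ g ∷ q → Sorted (p ++ [ f ]) → (f ≻ g) ≡ true →
            FirstDescent x

private
  headOr : List Labelled → Labelled → Labelled
  headOr []      f = f
  headOr (g ∷ _) _ = g

sorted-∷-or-descent : ∀ e p f → Sorted (p ++ [ f ]) →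
  Sorted (e ∷ p ++ [ f ]) ⊎ (e ≻ headOr p f) ≡ true
sorted-∷-or-descent e [] f _ with e ≻ f in eq
... | true  = inj₂ refl
... | false = inj₁ ((eq ∷ []) ∷ [] ∷ [])
sorted-∷-or-descent e (g ∷ p) f s with e ≻ g in eq
... | true  = inj₂ refl
... | false = inj₁ (sorted-∷ e g (p ++ [ f ]) eq s)

firstDescent : ∀ x → FirstDescent x
firstDescent-∷ : ∀ e x → FirstDescent x → FirstDescent (e ∷ x)
firstDescent []      = sorted []
firstDescent (e ∷ x) = firstDescent-∷ e x (firstDescent x)
firstDescent-∷ e _ (descent p f g q refl s f≻g) with sorted-∷-or-descent e p f s
... | inj₁ s′ = descent (e ∷ p) f g q refl s′ f≻g
firstDescent-∷ e _ (descent []      f g q refl _ _) | inj₂ e≻f =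
  descent [] e f (g ∷ q) refl ([] ∷ []) e≻f
firstDescent-∷ e _ (descent (k ∷ p) f g q refl _ _) | inj₂ e≻k =
  descent [] e k (p ++ f ∷ g ∷ q) refl ([] ∷ []) e≻k
firstDescent-∷ e []      (sorted _) = sorted ([] ∷ [])
firstDescent-∷ e (f ∷ x) (sorted s) with e ≻ f in eq
... | true  = descent [] e f x refl ([] ∷ []) eq
... | false = sorted (sorted-∷ e f x eq s)

data FirstDescentʳ (u : List Labelled) (e : Labelled) : Set where
  sorted : Sorted (u ++ [ e ]) → FirstDescentʳ u e
  inside : ∀ p f g q → u ≡ p ++ f ∷ g ∷ q → Sorted (p ++ [ f ]) → (f ≻ g) ≡ true →
           FirstDescentʳ u e
  atEnd  : ∀ p f → u ≡ p ++ [ f ] → Sorted (p ++ [ f ]) → (f ≻ e) ≡ true → FirstDescentʳ u e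

firstDescentʳ : ∀ u e → FirstDescentʳ u e
firstDescentʳ-∷ : ∀ k u e → FirstDescentʳ u e → FirstDescentʳ (k ∷ u) e
firstDescentʳ []      e = sorted ([] ∷ [])
firstDescentʳ (k ∷ u) e = firstDescentʳ-∷ k u e (firstDescentʳ u e)
firstDescentʳ-∷ k _ e (inside p f g q refl s f≻g) with sorted-∷-or-descent k p f s
... | inj₁ s′ = inside (k ∷ p) f g q refl s′ f≻g
firstDescentʳ-∷ k _ e (inside []      f g q refl _ _) | inj₂ k≻f =
  inside [] k f (g ∷ q) refl ([] ∷ []) k≻f
firstDescentʳ-∷ k _ e (inside (l ∷ p) f g q refl _ _) | inj₂ k≻l =
  inside [] k l (p ++ f ∷ g ∷ q) refl ([] ∷ []) k≻l
firstDescentʳ-∷ k _ e (atEnd p f refl s f≻e) with sorted-∷-or-descent k p f s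
... | inj₁ s′ = atEnd (k ∷ p) f refl s′ f≻e
firstDescentʳ-∷ k _ e (atEnd []      f refl _ _) | inj₂ k≻f = inside [] k f [] refl ([] ∷ []) k≻f
firstDescentʳ-∷ k _ e (atEnd (l ∷ p) f refl _ _) | inj₂ k≻l =
  inside [] k l (p ++ [ f ]) refl ([] ∷ []) k≻l
firstDescentʳ-∷ k u e (sorted s) with sorted-∷-or-descent k u e s
... | inj₁ s′ = sorted s′
firstDescentʳ-∷ k []      e (sorted _) | inj₂ k≻e = atEnd [] k refl ([] ∷ []) k≻e
firstDescentʳ-∷ k (l ∷ u) e (sorted _) | inj₂ k≻l = inside [] k l u refl ([] ∷ []) k≻l

inversions : List Labelled → ℕ
inversions []      = 0
inversions (e ∷ x) = countB (e ≻_) x Nat.+ inversions x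

inversions-swap : ∀ p f g q → (f ≻ g) ≡ true →
  inversions (p ++ f ∷ g ∷ q) ≡ suc (inversions (p ++ g ∷ f ∷ q))
inversions-swap [] f g q f≻g rewrite f≻g | >ᴸ-asym (letter f) (letter g) f≻g =
  cong suc (ℕ+-Props.x∙yz≈y∙xz (countB (f ≻_) q) (countB (g ≻_) q) (inversions q))
inversions-swap (e ∷ p) f g q f≻g
  rewrite countB-↭ (e ≻_) (↭-swapAt p f g q) | inversions-swap p f g q f≻g =
  ℕ.+-suc (countB (e ≻_) (p ++ g ∷ f ∷ q)) _

inversions-swap-< : ∀ p f g q → (f ≻ g) ≡ true →
  inversions (p ++ g ∷ f ∷ q) < inversions (p ++ f ∷ g ∷ q)
inversions-swap-< p f g q f≻g = ℕ.≤-reflexive (sym (inversions-swap p f g q f≻g))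

inversions-delete : ∀ p a q → inversions (p ++ q) ≤ inversions (p ++ a ∷ q)
inversions-delete []      a q = ℕ.m≤n+m (inversions q) (countB (a ≻_) q)
inversions-delete (e ∷ p) a q =
  ℕ.+-mono-≤ (countB-delete (e ≻_) p a q) (inversions-delete p a q)

inversions≤length² : ∀ x → inversions x ≤ length x Nat.* length x
inversions≤length² [] = z≤n
inversions≤length² (e ∷ x) = ℕ.m≤n⇒m≤1+n (ℕ.+-mono-≤ (countB≤length (e ≻_) x)
  (ℕ.≤-trans (inversions≤length² x) (ℕ.*-monoʳ-≤ (length x) (ℕ.n≤1+n (length x)))))

inversions-swap-<ʳ : ∀ p w f g q → (f ≻ g) ≡ true →
  inversions (p ++ w ++ g ∷ f ∷ q) < inversions (p ++ w ++ f ∷ g ∷ q)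
inversions-swap-<ʳ p w f g q f≻g = subst₂ _<_
  (cong inversions (List.++-assoc p w (g ∷ f ∷ q))) (cong inversions (List.++-assoc p w (f ∷ g ∷ q)))
  (inversions-swap-< (p ++ w) f g q f≻g)

inversions-deleteʳ : ∀ p w a q → inversions (p ++ w ++ q) ≤ inversions (p ++ w ++ a ∷ q)
inversions-deleteʳ p w a q = subst₂ _≤_
  (cong inversions (List.++-assoc p w q)) (cong inversions (List.++-assoc p w (a ∷ q)))
  (inversions-delete (p ++ w) a q)

inversions-drop : ∀ p f g q → (f ≻ g) ≡ true →
  inversions (p ++ f ∷ q) < inversions (p ++ f ∷ g ∷ q) × inversions (p ++ g ∷ q) < inversions (p ++ f ∷ g ∷ q)
inversions-drop p f g q f≻g =
  ℕ.≤-<-trans (inversions-delete p g (f ∷ q)) (inversions-swap-< p f g q f≻g) ,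
  ℕ.≤-<-trans (inversions-deleteʳ p [ g ] f q) (inversions-swap-< p f g q f≻g)

inversions-rec : ∀ {ℓ} (P : List Labelled → Set ℓ) →
  (∀ x → (∀ y → inversions y < inversions x → P y) → P x) → ∀ x → P x
inversions-rec {ℓ} P step =
  WF.All.wfRec (On.wellFounded inversions <-wellFounded) ℓ P (λ x ih → step x (λ y → ih {y}))

-- A word has exactly as many tiles as inversions, so this fuel is enough (tilesF-enough-fuel).
tiling : List Labelled → List Tile
tiling x = tilesF (inversions x) x

tilesF-sorted : ∀ fuel x → Sorted x → tilesF fuel x ≡ []
tilesF-sorted zero       x _ = refl
tilesF-sorted (suc fuel) x s rewrite step-sorted x s = refl

tilesF-descent : ∀ fuel p f g q → Sorted (p ++ [ f ]) → (f ≻ g) ≡ true →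
  tilesF (suc fuel) (p ++ f ∷ g ∷ q) ≡ tileOf f g ∷ tilesF fuel (p ++ g ∷ f ∷ q)
tilesF-descent fuel p f g q s f≻g rewrite step-descent p f g q s f≻g = refl

tiling-sorted : ∀ x → Sorted x → tiling x ≡ []
tiling-sorted x = tilesF-sorted (inversions x) x

tiling-descent : ∀ p f g q → Sorted (p ++ [ f ]) → (f ≻ g) ≡ true →
  tiling (p ++ f ∷ g ∷ q) ≡ tileOf f g ∷ tiling (p ++ g ∷ f ∷ q)
tiling-descent p f g q s f≻g rewrite inversions-swap p f g q f≻g =
  tilesF-descent (inversions (p ++ g ∷ f ∷ q)) p f g q s f≻g

tilesF-enough-fuel : ∀ fuel x → inversions x ≤ fuel → tilesF fuel x ≡ tiling x
tilesF-enough-fuel fuel x enough with firstDescent x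
... | sorted s = trans (tilesF-sorted fuel x s) (sym (tiling-sorted x s))
... | descent p f g q refl s f≻g =
  go fuel (subst (_≤ fuel) (inversions-swap p f g q f≻g) enough)
  where
  go : ∀ fuel → suc (inversions (p ++ g ∷ f ∷ q)) ≤ fuel →
       tilesF fuel (p ++ f ∷ g ∷ q) ≡ tiling (p ++ f ∷ g ∷ q)
  go (suc fuel) (s≤s enough′) = begin
    tilesF (suc fuel) (p ++ f ∷ g ∷ q)          ≡⟨ tilesF-descent fuel p f g q s f≻g ⟩
    tileOf f g ∷ tilesF fuel (p ++ g ∷ f ∷ q)   ≡⟨ cong (tileOf f g ∷_) (tilesF-enough-fuel fuel _ enough′) ⟩
    tileOf f g ∷ tiling (p ++ g ∷ f ∷ q)        ≡⟨ sym (tiling-descent p f g q s f≻g) ⟩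
    tiling (p ++ f ∷ g ∷ q)                     ∎
    where open ≡-Reasoning

labelWith : (ℕ → ℕ) → List Letter → List Labelled
labelWith g w = zip (applyUpTo g (length w)) w

length-labelWith : ∀ g w → length (labelWith g w) ≡ length w
length-labelWith g []      = refl
length-labelWith g (l ∷ w) = cong suc (length-labelWith (g ∘ suc) w)

maximalTiling≡tiling : ∀ w → maximalTiling w ≡ tiling (labelW w)
maximalTiling≡tiling w = tilesF-enough-fuel _ (labelW w)
  (subst (λ n → inversions (labelW w) ≤ n Nat.* n) (length-labelWith suc w) (inversions≤length² (labelW w)))

deleteLabel : ℕ → List Labelled → List Labelled
deleteLabel a []      = []
deleteLabel a (e ∷ x) = if label e ≡ᵇ a then deleteLabel a x else e ∷ deleteLabel a x

dropStrip : ℕ → List Tile → List Tile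
dropStrip a []       = []
dropStrip a (t ∷ ts) = if inStrip a t then dropStrip a ts else t ∷ dropStrip a ts

deleteLabel-++ : ∀ a p y → deleteLabel a (p ++ y) ≡ deleteLabel a p ++ deleteLabel a y
deleteLabel-++ a []      y = refl
deleteLabel-++ a (e ∷ p) y with label e ≡ᵇ a
... | true  = deleteLabel-++ a p y
... | false = cong (e ∷_) (deleteLabel-++ a p y)

All-deleteLabel : ∀ {P : Labelled → Set} a x → All P x → All P (deleteLabel a x)
All-deleteLabel a []      []         = []
All-deleteLabel a (e ∷ x) (pe ∷ px) with label e ≡ᵇ a
... | true  = All-deleteLabel a x px
... | false = pe ∷ All-deleteLabel a x px

AllPairs-deleteLabel : ∀ {R : Labelled → Labelled → Set} a x → AllPairs R x → AllPairs R (deleteLabel a x)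
AllPairs-deleteLabel a []      []         = []
AllPairs-deleteLabel a (e ∷ x) (re ∷ rx) with label e ≡ᵇ a
... | true  = AllPairs-deleteLabel a x rx
... | false = All-deleteLabel a x re ∷ AllPairs-deleteLabel a x rx

deleteLabel-swap : ∀ a p f g q → inStrip a (tileOf f g) ≡ true →
  deleteLabel a (p ++ f ∷ g ∷ q) ≡ deleteLabel a (p ++ g ∷ f ∷ q)
deleteLabel-swap a p f g q inS
  rewrite deleteLabel-++ a p (f ∷ g ∷ q) | deleteLabel-++ a p (g ∷ f ∷ q)
  with label f ≡ᵇ a | label g ≡ᵇ a | inS
... | true  | true  | _  = refl
... | true  | false | _  = refl
... | false | true  | _  = refl
... | false | false | ()

deleteLabel-kept : ∀ a p f y → (label f ≡ᵇ a) ≡ false →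
  deleteLabel a (p ++ f ∷ y) ≡ deleteLabel a p ++ f ∷ deleteLabel a y
deleteLabel-kept a p f y f≉a rewrite deleteLabel-++ a p (f ∷ y) | f≉a = refl

deleteLabel-kept₂ : ∀ a p f g q → (label f ≡ᵇ a) ≡ false → (label g ≡ᵇ a) ≡ false →
  deleteLabel a (p ++ f ∷ g ∷ q) ≡ deleteLabel a p ++ f ∷ g ∷ deleteLabel a q
deleteLabel-kept₂ a p f g q f≉a g≉a rewrite deleteLabel-kept a p f (g ∷ q) f≉a | g≉a = refl

-- A swap moving the letter labelled a is invisible once a is deleted; every other swap survives.
tiling-deleteLabel : ∀ a x → tiling (deleteLabel a x) ≡ dropStrip a (tiling x)
tiling-deleteLabel a = inversions-rec (λ x → tiling (deleteLabel a x) ≡ dropStrip a (tiling x)) go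
  where
  go : ∀ x → (∀ y → inversions y < inversions x → tiling (deleteLabel a y) ≡ dropStrip a (tiling y)) →
       tiling (deleteLabel a x) ≡ dropStrip a (tiling x)
  go x ih with firstDescent x
  ... | sorted s rewrite tiling-sorted x s = tiling-sorted (deleteLabel a x) (AllPairs-deleteLabel a x s)
  ... | descent p f g q refl s f≻g rewrite tiling-descent p f g q s f≻g with inStrip a (tileOf f g) in inS
  ... | true =
    trans (cong tiling (deleteLabel-swap a p f g q inS)) (ih (p ++ g ∷ f ∷ q) (inversions-swap-< p f g q f≻g))
  ... | false with ∨-false (label f ≡ᵇ a) (label g ≡ᵇ a) inS
  ... | f≉a , g≉a rewrite deleteLabel-kept₂ a p f g q f≉a g≉a = begin
    tiling (deleteLabel a p ++ f ∷ g ∷ deleteLabel a q)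
      ≡⟨ tiling-descent (deleteLabel a p) f g (deleteLabel a q) s′ f≻g ⟩
    tileOf f g ∷ tiling (deleteLabel a p ++ g ∷ f ∷ deleteLabel a q)
      ≡⟨ cong (λ y → tileOf f g ∷ tiling y) (sym (deleteLabel-kept₂ a p g f q g≉a f≉a)) ⟩
    tileOf f g ∷ tiling (deleteLabel a (p ++ g ∷ f ∷ q))
      ≡⟨ cong (tileOf f g ∷_) (ih (p ++ g ∷ f ∷ q) (inversions-swap-< p f g q f≻g)) ⟩
    tileOf f g ∷ dropStrip a (tiling (p ++ g ∷ f ∷ q)) ∎
    where
    open ≡-Reasoning
    s′ : Sorted (deleteLabel a p ++ [ f ])
    s′ = subst Sorted (deleteLabel-kept a p f [] f≉a) (AllPairs-deleteLabel a (p ++ [ f ]) s)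

countB-deleteLabel : ∀ (P : Labelled → Bool) a x → All (λ e → (label e ≡ᵇ a) ≡ true → P e ≡ false) x →
  countB P x ≡ countB P (deleteLabel a x)
countB-deleteLabel P a []      []       = refl
countB-deleteLabel P a (e ∷ x) (h ∷ hs) with label e ≡ᵇ a
... | true rewrite h refl = countB-deleteLabel P a x hs
... | false = cong (λ k → if P e then suc k else k) (countB-deleteLabel P a x hs)

_∉labels_ : ℕ → List Labelled → Set
a ∉labels x = All (λ e → (label e ≡ᵇ a) ≡ false) x

Distinct : List Labelled → Set
Distinct = AllPairs (λ e f → (label f ≡ᵇ label e) ≡ false)

deleteLabel-∉ : ∀ a x → a ∉labels x → deleteLabel a x ≡ x
deleteLabel-∉ a []      []          = refl
deleteLabel-∉ a (e ∷ x) (e≉a ∷ a∉x) rewrite e≉a = cong (e ∷_) (deleteLabel-∉ a x a∉x)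

∉labels-vacuous : ∀ {P : Labelled → Set} a y → a ∉labels y → All (λ e → (label e ≡ᵇ a) ≡ true → P e) y
∉labels-vacuous a y = All.map (λ e≉a e≈a → true≢false (trans (sym e≈a) e≉a))

record DistinctAt (p : List Labelled) (f g : Labelled) (q : List Labelled) : Set where
  field
    f∉p : label f ∉labels p
    f∉q : label f ∉labels q
    g∉p : label g ∉labels p
    g∉q : label g ∉labels q
    g≉f : (label g ≡ᵇ label f) ≡ false
    f≉g : (label f ≡ᵇ label g) ≡ false

distinctAt : ∀ p f g q → Distinct (p ++ f ∷ g ∷ q) → DistinctAt p f g q
distinctAt p f g q d with AllPairs-++⁻ʳ p d
... | (g≉f ∷ f∉q) ∷ g∉q ∷ _ = record
  { f∉p = All.map proj₁ (outside p d)
  ; f∉q = f∉q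
  ; g∉p = All.map proj₂ (outside p d)
  ; g∉q = g∉q
  ; g≉f = g≉f
  ; f≉g = trans (≡ᵇ-sym (label f) (label g)) g≉f
  }
  where
  outside : ∀ p → Distinct (p ++ f ∷ g ∷ q) →
    All (λ e → ((label e ≡ᵇ label f) ≡ false) × ((label e ≡ᵇ label g) ≡ false)) p
  outside []      _          = []
  outside (e ∷ p) (e∉ ∷ d) with All.++⁻ʳ p e∉
  ... | f≉e ∷ g≉e ∷ _ =
    (trans (≡ᵇ-sym (label e) (label f)) f≉e , trans (≡ᵇ-sym (label e) (label g)) g≉e) ∷ outside p d

deleteLabel-first : ∀ p f g q → DistinctAt p f g q → deleteLabel (label g) (p ++ g ∷ f ∷ q) ≡ p ++ f ∷ q
deleteLabel-first p f g q d
  rewrite deleteLabel-++ (label g) p (g ∷ f ∷ q) | deleteLabel-∉ (label g) p (DistinctAt.g∉p d)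
        | ≡ᵇ-refl (label g) | DistinctAt.f≉g d | deleteLabel-∉ (label g) q (DistinctAt.g∉q d) = refl

deleteLabel-second : ∀ p f g q → DistinctAt p f g q → deleteLabel (label f) (p ++ g ∷ f ∷ q) ≡ p ++ g ∷ q
deleteLabel-second p f g q d
  rewrite deleteLabel-++ (label f) p (g ∷ f ∷ q) | deleteLabel-∉ (label f) p (DistinctAt.f∉p d)
        | DistinctAt.g≉f d | ≡ᵇ-refl (label f) | deleteLabel-∉ (label f) q (DistinctAt.f∉q d) = refl

relabel : (ℕ → ℕ) → Labelled → Labelled
relabel π (a , l) = (π a , l)

sorted-relabel : ∀ π x → Sorted x → Sorted (map (relabel π) x)
sorted-relabel π x = AllPairs.map⁺

transpose : ℕ → ℕ → ℕ → ℕ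
transpose a b ℓ = if ℓ ≡ᵇ a then b else if ℓ ≡ᵇ b then a else ℓ

transpose-fixes : ∀ a b y → a ∉labels y → b ∉labels y → map (relabel (transpose a b)) y ≡ y
transpose-fixes a b []            []          []          = refl
transpose-fixes a b ((ℓ , l) ∷ y) (ℓ≉a ∷ a∉y) (ℓ≉b ∷ b∉y) rewrite ℓ≉a | ℓ≉b =
  cong ((ℓ , l) ∷_) (transpose-fixes a b y a∉y b∉y)

transpose-a : ∀ a b → transpose a b a ≡ b
transpose-a a b rewrite ≡ᵇ-refl a = refl

transpose-b : ∀ a b → transpose a b b ≡ a
transpose-b a b with b ≡ᵇ a in b≈a
... | true  = ≡ᵇ-true⇒≡ b a b≈a
... | false rewrite ≡ᵇ-refl b = refl

∅ : ℕ → Bool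
∅ _ = false

insert : ℕ → (ℕ → Bool) → ℕ → Bool
insert b s ℓ = (ℓ ≡ᵇ b) ∨ s ℓ

markTile : Tile → (ℕ → Bool) → ℕ → Bool
markTile t s ℓ = inStrip ℓ t ∨ s ℓ

-- The state after filling an initial segment of the tiles (taken in production order, so an
-- arrow points exactly at the later tiles of its strip): the strips pointed into by an
-- arrow, and the strips containing a left-arrow, resp. an up-arrow.
record Marks : Set where
  constructor marks
  field
    blocked hasLeft hasUp : ℕ → Bool
open Marks

unmarked : Marks
unmarked = marks ∅ ∅ ∅

placeUp placeLeft : Tile → Marks → Marks
placeUp   t σ = marks (insert (lab₂ t) (blocked σ)) (hasLeft σ) (markTile t (hasUp σ))
placeLeft t σ = marks (insert (lab₁ t) (blocked σ)) (markTile t (hasLeft σ)) (hasUp σ)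

isBlocked : Marks → Tile → Bool
isBlocked σ t = blocked σ (lab₁ t) ∨ blocked σ (lab₂ t)

upAllowed leftAllowed : Marks → Tile → Bool
upAllowed   σ t = (let₂ t =ᴸ L0) ∧ not (isBlocked σ t)
leftAllowed σ t = (let₁ t =ᴸ L2) ∧ not (isBlocked σ t)

freeRow freeColumn : Marks → Labelled → Bool
freeRow    σ e = (letter e =ᴸ L2) ∧ not (hasLeft σ (label e))
freeColumn σ e = (letter e =ᴸ L0) ∧ not (hasUp σ (label e))

NotFree : Marks → Labelled → Set
NotFree σ e = (freeRow σ e ≡ false) × (freeColumn σ e ≡ false)

SameFree : Marks → Marks → Labelled → Set
SameFree σ σ′ e = (freeRow σ e ≡ freeRow σ′ e) × (freeColumn σ e ≡ freeColumn σ′ e)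

NotFree-placeUp : ∀ t σ {e} → NotFree σ e → NotFree (placeUp t σ) e
NotFree-placeUp t σ {e} (r , c) =
  r , trans (∧-not-∨ (letter e =ᴸ L0) (inStrip (label e) t) (hasUp σ (label e))) (cong (_∧ _) c)

NotFree-placeLeft : ∀ t σ {e} → NotFree σ e → NotFree (placeLeft t σ) e
NotFree-placeLeft t σ {e} (r , c) =
  trans (∧-not-∨ (letter e =ᴸ L2) (inStrip (label e) t) (hasLeft σ (label e))) (cong (_∧ _) r) , c

SameFree-placeUp : ∀ t σ σ′ {e} → SameFree σ σ′ e → SameFree (placeUp t σ) (placeUp t σ′) e
SameFree-placeUp t σ σ′ {e} (r , c) = r , (begin
  (letter e =ᴸ L0) ∧ not (markTile t (hasUp σ) (label e))   ≡⟨ ∧-not-∨ _ (inStrip (label e) t) _ ⟩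
  freeColumn σ e ∧ not (inStrip (label e) t)                ≡⟨ cong (_∧ _) c ⟩
  freeColumn σ′ e ∧ not (inStrip (label e) t)               ≡⟨ sym (∧-not-∨ _ (inStrip (label e) t) _) ⟩
  (letter e =ᴸ L0) ∧ not (markTile t (hasUp σ′) (label e))  ∎)
  where open ≡-Reasoning

SameFree-placeLeft : ∀ t σ σ′ {e} → SameFree σ σ′ e → SameFree (placeLeft t σ) (placeLeft t σ′) e
SameFree-placeLeft t σ σ′ {e} (r , c) = (begin
  (letter e =ᴸ L2) ∧ not (markTile t (hasLeft σ) (label e))   ≡⟨ ∧-not-∨ _ (inStrip (label e) t) _ ⟩
  freeRow σ e ∧ not (inStrip (label e) t)                     ≡⟨ cong (_∧ _) r ⟩
  freeRow σ′ e ∧ not (inStrip (label e) t)                    ≡⟨ sym (∧-not-∨ _ (inStrip (label e) t) _) ⟩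
  (letter e =ᴸ L2) ∧ not (markTile t (hasLeft σ′) (label e))  ∎) , c
  where open ≡-Reasoning

offStrip : ∀ t y → lab₁ t ∉labels y → lab₂ t ∉labels y → All (λ e → inStrip (label e) t ≡ false) y
offStrip t []      []          []          = []
offStrip t (e ∷ y) (e≉a ∷ a∉y) (e≉b ∷ b∉y) =
  cong₂ _∨_ (trans (≡ᵇ-sym (lab₁ t) (label e)) e≉a) (trans (≡ᵇ-sym (lab₂ t) (label e)) e≉b) ∷ offStrip t y a∉y b∉y

SameFree-offStrip : ∀ t σ {e} → inStrip (label e) t ≡ false →
  SameFree (placeLeft t σ) σ e × SameFree (placeUp t σ) σ e
SameFree-offStrip t σ e∉t rewrite e∉t = (refl , refl) , (refl , refl)

SameFree-offTile : ∀ t σ y → lab₁ t ∉labels y → lab₂ t ∉labels y →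
  All (SameFree (placeLeft t σ) σ) y × All (SameFree (placeUp t σ) σ) y
SameFree-offTile t σ y a∉y b∉y =
  All.map (proj₁ ∘ SameFree-offStrip t σ) (offStrip t y a∉y b∉y) ,
  All.map (proj₂ ∘ SameFree-offStrip t σ) (offStrip t y a∉y b∉y)

StripBlocked : ℕ → Marks → Marks → Set
StripBlocked a σ σ′ = ∀ ℓ → blocked σ ℓ ≡ insert a (blocked σ′) ℓ

StripBlocked-insert : ∀ a b σ σ′ → StripBlocked a σ σ′ → ∀ ℓ →
  insert b (blocked σ) ℓ ≡ insert a (insert b (blocked σ′)) ℓ
StripBlocked-insert a b σ σ′ a-blocked ℓ =
  trans (cong ((ℓ ≡ᵇ b) ∨_) (a-blocked ℓ)) (∨-Props.x∙yz≈y∙xz (ℓ ≡ᵇ b) (ℓ ≡ᵇ a) (blocked σ′ ℓ))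

StripBlocked-placeUp : ∀ a t σ σ′ → StripBlocked a σ σ′ → StripBlocked a (placeUp t σ) (placeUp t σ′)
StripBlocked-placeUp a t σ σ′ = StripBlocked-insert a (lab₂ t) σ σ′

StripBlocked-placeLeft : ∀ a t σ σ′ → StripBlocked a σ σ′ → StripBlocked a (placeLeft t σ) (placeLeft t σ′)
StripBlocked-placeLeft a t σ σ′ = StripBlocked-insert a (lab₁ t) σ σ′

isBlocked-inStrip : ∀ a σ σ′ t → StripBlocked a σ σ′ → inStrip a t ≡ true → isBlocked σ t ≡ true
isBlocked-inStrip a σ σ′ t a-blocked t∈a rewrite a-blocked (lab₁ t) | a-blocked (lab₂ t)
  with lab₁ t ≡ᵇ a | lab₂ t ≡ᵇ a | t∈a
... | true  | _     | _  = refl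
... | false | true  | _  = ∨-zeroʳ _
... | false | false | ()

isBlocked-offStrip : ∀ a σ σ′ t → StripBlocked a σ σ′ → inStrip a t ≡ false → isBlocked σ t ≡ isBlocked σ′ t
isBlocked-offStrip a σ σ′ t a-blocked t∉a rewrite a-blocked (lab₁ t) | a-blocked (lab₂ t)
  with ∨-false (lab₁ t ≡ᵇ a) (lab₂ t ≡ᵇ a) t∉a
... | eq₁ , eq₂ rewrite eq₁ | eq₂ = refl

markArrow : Tile → Arrow → Marks → Marks
markArrow t none σ = σ
markArrow t up   σ = placeUp t σ
markArrow t left σ = placeLeft t σ

markAll : List Tile → List Arrow → Marks → Marks
markAll (t ∷ ts) (a ∷ f) σ = markAll ts f (markArrow t a σ)
markAll _        _       σ = σ

arrowOk : Marks → Tile → Arrow → Bool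
arrowOk σ t a = allowed t a ∧ not (isArrow a ∧ isBlocked σ t)

validFrom : Marks → List Tile → List Arrow → Bool
validFrom σ (t ∷ ts) (a ∷ f) = arrowOk σ t a ∧ validFrom (markArrow t a σ) ts f
validFrom σ _        _       = true

indexed : (ℕ → ℕ) → List Tile → List Arrow → List Placed
indexed g ts f = zip (applyUpTo g (length ts)) (zip ts f)

index : Placed → ℕ
index = proj₁

arrowAt : Placed → Arrow
arrowAt = proj₂ ∘ proj₂

tileAt : Placed → Tile
tileAt = proj₁ ∘ proj₂

notPointedBy : Placed → Placed → Bool
notPointedBy p q = not (isArrow (arrowAt q) ∧ pointsTo p q)

unblocked : Marks → List Placed → Bool
unblocked σ = all (λ q → not (isArrow (arrowAt q) ∧ isBlocked σ (tileAt q)))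

isBlocked-insert : ∀ b σ t′ →
  isBlocked (record σ { blocked = insert b (blocked σ) }) t′ ≡ inStrip b t′ ∨ isBlocked σ t′
isBlocked-insert b σ t′ = ∨-Props.interchange (lab₁ t′ ≡ᵇ b) (blocked σ (lab₁ t′)) (lab₂ t′ ≡ᵇ b) (blocked σ (lab₂ t′))

notPointedBy-self : ∀ k t a → notPointedBy (k , t , a) (k , t , a) ≡ true
notPointedBy-self k t none = refl
notPointedBy-self k t up   rewrite <ᵇ-irrefl k = refl
notPointedBy-self k t left rewrite <ᵇ-irrefl k = refl

notPointedBy-earlier : ∀ p q → index p < index q → notPointedBy q p ≡ true
notPointedBy-earlier p (k , t , none) _ rewrite ∧-zeroʳ (isArrow (arrowAt p)) = refl
notPointedBy-earlier p (k , t , up)   p<q rewrite <⇒>ᵇ-false p<q | ∧-zeroʳ (isArrow (arrowAt p)) = refl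
notPointedBy-earlier p (k , t , left) p<q rewrite <⇒>ᵇ-false p<q | ∧-zeroʳ (isArrow (arrowAt p)) = refl

-- An arrow at index k forbids exactly the later arrows of the strip it blocks.
unblocked-markArrow : ∀ k t a σ L → All (λ q → k < index q) L →
  all (notPointedBy (k , t , a)) L ∧ unblocked σ L ≡ unblocked (markArrow t a σ) L
unblocked-markArrow k t a σ L later =
  trans (all-∧ _ _ L) (all-congᴬ (All.map (λ {q} → blocks a q) later))
  where
  blocks : ∀ a q → k < index q →
    notPointedBy (k , t , a) q ∧ not (isArrow (arrowAt q) ∧ isBlocked σ (tileAt q)) ≡
    not (isArrow (arrowAt q) ∧ isBlocked (markArrow t a σ) (tileAt q))
  blocks none q _ rewrite ∧-zeroʳ (isArrow (arrowAt q)) = refl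
  blocks up q k<q rewrite <⇒<ᵇ-true k<q | isBlocked-insert (lab₂ t) σ (tileAt q) =
    not-∧-∨ (isArrow (arrowAt q)) (inStrip (lab₂ t) (tileAt q)) (isBlocked σ (tileAt q))
  blocks left q k<q rewrite <⇒<ᵇ-true k<q | isBlocked-insert (lab₁ t) σ (tileAt q) =
    not-∧-∨ (isArrow (arrowAt q)) (inStrip (lab₁ t) (tileAt q)) (isBlocked σ (tileAt q))

indexed-above : ∀ g k → (∀ i → k < g i) → ∀ ts f → All (λ q → k < index q) (indexed g ts f)
indexed-above g k k<g []       _       = []
indexed-above g k k<g (t ∷ ts) []      = []
indexed-above g k k<g (t ∷ ts) (a ∷ f) = k<g 0 ∷ indexed-above (g ∘ suc) k (k<g ∘ suc) ts f

validPlaced-indexed : ∀ g → (∀ {i j} → i < j → g i < g j) → ∀ ts f σ →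
  validPlaced (indexed g ts f) ∧ unblocked σ (indexed g ts f) ≡ validFrom σ ts f
validPlaced-indexed g g-mono []       _       σ = refl
validPlaced-indexed g g-mono (t ∷ ts) []      σ = refl
validPlaced-indexed g g-mono (t ∷ ts) (a ∷ f) σ = begin
  ((Ok ∧ As) ∧ ((notPointedBy x x ∧ Cx) ∧ all (λ p → notPointedBy p x ∧ all (notPointedBy p) L) L)) ∧ (nb ∧ NB)
    ≡⟨ cong₂ (λ c P → ((Ok ∧ As) ∧ ((c ∧ Cx) ∧ P)) ∧ (nb ∧ NB)) (notPointedBy-self (g 0) t a)
         (all-congᴬ (All.map (λ {p} x<p → cong (_∧ _) (notPointedBy-earlier x p x<p)) later)) ⟩
  ((Ok ∧ As) ∧ (Cx ∧ P)) ∧ (nb ∧ NB)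
    ≡⟨ ∧-solve 6 (λ Ok As Cx P nb NB → ((Ok ⊕ As) ⊕ (Cx ⊕ P)) ⊕ (nb ⊕ NB) ⊜ (Ok ⊕ nb) ⊕ ((As ⊕ P) ⊕ (Cx ⊕ NB))) refl
         Ok As Cx P nb NB ⟩
  (Ok ∧ nb) ∧ ((As ∧ P) ∧ (Cx ∧ NB))
    ≡⟨ cong (λ v → (Ok ∧ nb) ∧ ((As ∧ P) ∧ v)) (unblocked-markArrow (g 0) t a σ L later) ⟩
  (Ok ∧ nb) ∧ (validPlaced L ∧ unblocked (markArrow t a σ) L)
    ≡⟨ cong ((Ok ∧ nb) ∧_) (validPlaced-indexed (g ∘ suc) (g-mono ∘ s≤s) ts f (markArrow t a σ)) ⟩
  arrowOk σ t a ∧ validFrom (markArrow t a σ) ts f ∎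
  where
  open ≡-Reasoning
  open import Algebra.Solver.CommutativeMonoid ∧-commutativeMonoid using (_⊕_; _⊜_) renaming (solve to ∧-solve)
  x = (g 0 , t , a)
  L = indexed (g ∘ suc) ts f
  Ok = allowed t a
  As = all (λ p → allowed (tileAt p) (arrowAt p)) L
  Cx = all (notPointedBy x) L
  P = all (λ p → all (notPointedBy p) L) L
  nb = not (isArrow a ∧ isBlocked σ t)
  NB = unblocked σ L
  later : All (λ q → g 0 < index q) L
  later = indexed-above (g ∘ suc) (g 0) (λ i → g-mono (s≤s z≤n)) ts f

leftIn upIn arrowIn : ℕ → Placed → Bool
leftIn  ℓ p = isLeft (arrowAt p) ∧ inStrip ℓ (tileAt p)
upIn    ℓ p = isUp (arrowAt p) ∧ inStrip ℓ (tileAt p)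
arrowIn ℓ p = isArrow (arrowAt p) ∧ inStrip ℓ (tileAt p)

hasLeft-markAll : ∀ g ts f σ ℓ → hasLeft (markAll ts f σ) ℓ ≡ any (leftIn ℓ) (indexed g ts f) ∨ hasLeft σ ℓ
hasLeft-markAll g []       _       σ ℓ = refl
hasLeft-markAll g (t ∷ ts) []      σ ℓ = refl
hasLeft-markAll g (t ∷ ts) (a ∷ f) σ ℓ rewrite hasLeft-markAll (g ∘ suc) ts f (markArrow t a σ) ℓ with a
... | none = refl
... | up   = refl
... | left = trans (∨-Props.x∙yz≈y∙xz (any (leftIn ℓ) (indexed (g ∘ suc) ts f)) (inStrip ℓ t) (hasLeft σ ℓ))
                   (sym (∨-assoc (inStrip ℓ t) _ _))

hasUp-markAll : ∀ g ts f σ ℓ → hasUp (markAll ts f σ) ℓ ≡ any (upIn ℓ) (indexed g ts f) ∨ hasUp σ ℓ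
hasUp-markAll g []       _       σ ℓ = refl
hasUp-markAll g (t ∷ ts) []      σ ℓ = refl
hasUp-markAll g (t ∷ ts) (a ∷ f) σ ℓ rewrite hasUp-markAll (g ∘ suc) ts f (markArrow t a σ) ℓ with a
... | none = refl
... | left = refl
... | up   = trans (∨-Props.x∙yz≈y∙xz (any (upIn ℓ) (indexed (g ∘ suc) ts f)) (inStrip ℓ t) (hasUp σ ℓ))
                   (sym (∨-assoc (inStrip ℓ t) _ _))

validPlaced-placed : ∀ ts f → validPlaced (place ts f) ≡ validFrom unmarked ts f
validPlaced-placed ts f = begin
  validPlaced (place ts f)                               ≡⟨ sym (∧-identityʳ _) ⟩
  validPlaced (place ts f) ∧ true                        ≡⟨ cong (validPlaced (place ts f) ∧_) (sym none-blocked) ⟩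
  validPlaced (place ts f) ∧ unblocked unmarked (place ts f)
    ≡⟨ validPlaced-indexed (λ k → k) (λ i<j → i<j) ts f unmarked ⟩
  validFrom unmarked ts f                                ∎
  where
  open ≡-Reasoning
  none-blocked : unblocked unmarked (place ts f) ≡ true
  none-blocked = all-true (place ts f) (λ q → cong not (∧-zeroʳ (isArrow (arrowAt q))))

diagonalLabels : List Labelled → List ℕ
diagonalLabels x = map label (filter (λ e → (letter e =ᴸ L1) Data.Bool.≟ true) x)

Template : Set
Template = List (ℕ × Bool)

completions : Template → List (List Labelled)
completions []                 = [] ∷ []
completions ((ℓ , true)  ∷ tm) = map ((ℓ , L1) ∷_) (completions tm)
completions ((ℓ , false) ∷ tm) = map ((ℓ , L0) ∷_) (completions tm) ++ map ((ℓ , L2) ∷_) (completions tm)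

holes : Template → ℕ
holes []                 = 0
holes ((_ , true)  ∷ tm) = holes tm
holes ((_ , false) ∷ tm) = suc (holes tm)

ones : Template → List ℕ
ones []                 = []
ones ((ℓ , true)  ∷ tm) = ℓ ∷ ones tm
ones ((_ , false) ∷ tm) = ones tm

All-ones : ∀ {P : ℕ → Set} tm → All (λ p → P (proj₁ p)) tm → All P (ones tm)
All-ones []                 []       = []
All-ones ((_ , true)  ∷ tm) (p ∷ ps) = p ∷ All-ones tm ps
All-ones ((_ , false) ∷ tm) (_ ∷ ps) = All-ones tm ps

completions-labels : ∀ tm → All (λ y → map label y ≡ map proj₁ tm) (completions tm)
completions-labels [] = refl ∷ []
completions-labels ((ℓ , true) ∷ tm) = All.map⁺ (All.map (cong (ℓ ∷_)) (completions-labels tm))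
completions-labels ((ℓ , false) ∷ tm) =
  All.++⁺ (All.map⁺ (All.map (cong (ℓ ∷_)) (completions-labels tm)))
          (All.map⁺ (All.map (cong (ℓ ∷_)) (completions-labels tm)))

completions-diagonal : ∀ tm → All (λ y → diagonalLabels y ≡ ones tm) (completions tm)
completions-diagonal [] = refl ∷ []
completions-diagonal ((ℓ , true) ∷ tm) = All.map⁺ (All.map (cong (ℓ ∷_)) (completions-diagonal tm))
completions-diagonal ((ℓ , false) ∷ tm) =
  All.++⁺ (All.map⁺ (completions-diagonal tm)) (All.map⁺ (completions-diagonal tm))

completions-letters : ∀ tm {P : ℕ → Set} → All (λ p → proj₂ p ≡ false → P (proj₁ p)) tm →
  All (All (λ e → letter e ≡ L1 ⊎ P (label e))) (completions tm)
completions-letters [] [] = [] ∷ []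
completions-letters ((ℓ , true) ∷ tm) (_ ∷ hs) = All.map⁺ (All.map (inj₁ refl ∷_) (completions-letters tm hs))
completions-letters ((ℓ , false) ∷ tm) (h ∷ hs) =
  All.++⁺ (All.map⁺ (All.map (inj₂ (h refl) ∷_) (completions-letters tm hs)))
          (All.map⁺ (All.map (inj₂ (h refl) ∷_) (completions-letters tm hs)))

All-completions-hole : ∀ {P : List Labelled → Set} ℓ tm → All P (completions ((ℓ , false) ∷ tm)) →
  All (λ y → P ((ℓ , L0) ∷ y)) (completions tm) × All (λ y → P ((ℓ , L2) ∷ y)) (completions tm)
All-completions-hole ℓ tm all =
  All.map⁻ (All.++⁻ˡ (map ((ℓ , L0) ∷_) (completions tm)) all) ,
  All.map⁻ (All.++⁻ʳ (map ((ℓ , L0) ∷_) (completions tm)) all)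

DistinctLabels : List ℕ → Set
DistinctLabels = AllPairs (λ ℓ m → (m ≡ᵇ ℓ) ≡ false)

holes-off-ones : ∀ tm → DistinctLabels (map proj₁ tm) →
  All (λ p → proj₂ p ≡ false → All (λ o → (proj₁ p ≡ᵇ o) ≡ false) (ones tm)) tm
holes-off-ones [] [] = []
holes-off-ones ((ℓ , true) ∷ tm) (ℓ∉ ∷ d) =
  (λ ()) ∷ All.zipWith (λ (h , m≉ℓ) m-hole → m≉ℓ ∷ h m-hole) (holes-off-ones tm d , All.map⁻ ℓ∉)
holes-off-ones ((ℓ , false) ∷ tm) (ℓ∉ ∷ d) =
  (λ _ → All.map (λ {o} o≉ℓ → trans (≡ᵇ-sym ℓ o) o≉ℓ) (All-ones tm (All.map⁻ ℓ∉))) ∷ holes-off-ones tm d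

ones-distinct : ∀ tm → DistinctLabels (map proj₁ tm) → DistinctLabels (ones tm)
ones-distinct []                 []         = []
ones-distinct ((ℓ , true)  ∷ tm) (ℓ∉ ∷ d)   = All-ones tm (All.map⁻ ℓ∉) ∷ ones-distinct tm d
ones-distinct ((ℓ , false) ∷ tm) (_ ∷ d) = ones-distinct tm d

shapes : List Bool → List (List Letter)
shapes []          = [] ∷ []
shapes (true  ∷ s) = map (L1 ∷_) (shapes s)
shapes (false ∷ s) = map (L0 ∷_) (shapes s) ++ map (L2 ∷_) (shapes s)

patterns : ℕ → ℕ → List (List Bool)
patterns zero    zero    = [] ∷ []
patterns zero    (suc r) = []
patterns (suc n) zero    = map (false ∷_) (patterns n zero)
patterns (suc n) (suc r) = map (true ∷_) (patterns n r) ++ map (false ∷_) (patterns n (suc r))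

trues : List Bool → ℕ
trues = countB (λ b → b)

patterns-shape : ∀ n r → All (λ s → length s ≡ n × trues s ≡ r) (patterns n r)
patterns-shape zero    zero    = (refl , refl) ∷ []
patterns-shape zero    (suc r) = []
patterns-shape (suc n) zero    = All.map⁺ (All.map (λ (l , t) → cong suc l , t) (patterns-shape n zero))
patterns-shape (suc n) (suc r) =
  All.++⁺ (All.map⁺ (All.map (λ (l , t) → cong suc l , cong suc t) (patterns-shape n r)))
          (All.map⁺ (All.map (λ (l , t) → cong suc l , t) (patterns-shape n (suc r))))

length-patterns : ∀ n r → length (patterns n r) ≡ n C r
length-patterns zero    zero    = refl
length-patterns zero    (suc r) = refl
length-patterns (suc n) zero    = trans (List.length-map (false ∷_) (patterns n zero)) (length-patterns n zero)
length-patterns (suc n) (suc r) = begin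
  length (map (true ∷_) (patterns n r) ++ map (false ∷_) (patterns n (suc r)))
    ≡⟨ List.length-++ (map (true ∷_) (patterns n r)) ⟩
  length (map (true ∷_) (patterns n r)) Nat.+ length (map (false ∷_) (patterns n (suc r)))
    ≡⟨ cong₂ Nat._+_ (trans (List.length-map _ (patterns n r)) (length-patterns n r))
                     (trans (List.length-map _ (patterns n (suc r))) (length-patterns n (suc r))) ⟩
  n C r Nat.+ n C suc r
    ≡⟨ nCk+nC[k+1]≡[n+1]C[k+1] n r ⟩
  suc n C suc r ∎
  where open ≡-Reasoning

template : (ℕ → ℕ) → List Bool → Template
template g s = zip (applyUpTo g (length s)) s

labelWith-shapes : ∀ g s → map (labelWith g) (shapes s) ≡ completions (template g s)
labelWith-prefixed : ∀ g l s →
  map (labelWith g) (map (l ∷_) (shapes s)) ≡ map ((g 0 , l) ∷_) (completions (template (g ∘ suc) s))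
labelWith-shapes g []          = refl
labelWith-shapes g (true ∷ s)  = labelWith-prefixed g L1 s
labelWith-shapes g (false ∷ s) = trans (List.map-++ (labelWith g) (map (L0 ∷_) (shapes s)) _)
  (cong₂ _++_ (labelWith-prefixed g L0 s) (labelWith-prefixed g L2 s))
labelWith-prefixed g l s = trans (sym (List.map-∘ (shapes s)))
  (trans (List.map-∘ (shapes s)) (cong (map ((g 0 , l) ∷_)) (labelWith-shapes (g ∘ suc) s)))

template-labels : ∀ g s → map proj₁ (template g s) ≡ applyUpTo g (length s)
template-labels g []      = refl
template-labels g (b ∷ s) = cong (g 0 ∷_) (template-labels (g ∘ suc) s)

template-distinct : ∀ g → (∀ {i j} → i < j → g i < g j) → ∀ s → DistinctLabels (map proj₁ (template g s))
template-distinct g g-mono s = subst DistinctLabels (sym (template-labels g s))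
  (AllPairs.applyUpTo⁺₁ g (length s) (λ i<j _ → ≢⇒≡ᵇ-false _ _ (ℕ.<⇒≢ (g-mono i<j) ∘ sym)))

holes-template : ∀ g s → holes (template g s) ≡ length s ∸ trues s
holes-template g []          = refl
holes-template g (true ∷ s)  = holes-template (g ∘ suc) s
holes-template g (false ∷ s) = trans (cong suc (holes-template (g ∘ suc) s)) (sym (ℕ.+-∸-assoc 1 (countB≤length _ s)))

length-ones-template : ∀ g s → length (ones (template g s)) ≡ trues s
length-ones-template g []          = refl
length-ones-template g (true ∷ s)  = cong suc (length-ones-template (g ∘ suc) s)
length-ones-template g (false ∷ s) = length-ones-template (g ∘ suc) s

module WeightedSums {c ℓ : Level} (S : CommutativeSemiring c ℓ) where
  open CommutativeSemiring S
    using (_≈_; 0#; 1#; _+_; _*_; setoid; reflexive; +-cong; *-cong; +-congˡ; +-congʳ; *-congˡ; *-congʳ;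
           +-identityˡ; +-identityʳ; *-identityˡ; *-identityʳ; zeroˡ; zeroʳ; +-assoc; *-assoc; *-comm;
           distribˡ; distribʳ)
    renaming (Carrier to C; refl to ≈-refl; sym to ≈-sym; trans to ≈-trans)
  open Gen S
  open import Relation.Binary.Reasoning.Setoid setoid
  open import Algebra.Solver.Ring.NaturalCoefficients.Default S using (solve; _:+_; _:*_; _:=_; con)
  private
    module +-Props = CommutativeSemigroupProperties (CommutativeSemiring.+-commutativeSemigroup S)
    module *-Props = CommutativeSemigroupProperties (CommutativeSemiring.*-commutativeSemigroup S)

  private variable
    i j : Level
    I : Set i
    J : Set j

  ∑ : List I → (I → C) → C
  ∑ L f = sumS (map f L)

  ∑-congᴬ : {L : List I} {f g : I → C} → All (λ a → f a ≈ g a) L → ∑ L f ≈ ∑ L g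
  ∑-congᴬ []          = ≈-refl
  ∑-congᴬ (fa≈ga ∷ r) = +-cong fa≈ga (∑-congᴬ r)

  ∑-cong : (L : List I) {f g : I → C} → (∀ a → f a ≈ g a) → ∑ L f ≈ ∑ L g
  ∑-cong L f≈g = ∑-congᴬ (All.universal f≈g L)

  ∑-map : (g : I → J) (L : List I) (f : J → C) → ∑ (map g L) f ≡ ∑ L (λ a → f (g a))
  ∑-map g L f = cong sumS (sym (List.map-∘ L))

  ∑-++ : (L M : List I) (f : I → C) → ∑ (L ++ M) f ≈ ∑ L f + ∑ M f
  ∑-++ []      M f = ≈-sym (+-identityˡ _)
  ∑-++ (a ∷ L) M f = ≈-trans (+-congˡ (∑-++ L M f)) (≈-sym (+-assoc (f a) _ _))

  ∑-0 : (L : List I) → ∑ L (λ _ → 0#) ≈ 0#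
  ∑-0 []      = ≈-refl
  ∑-0 (a ∷ L) = ≈-trans (+-congˡ (∑-0 L)) (+-identityʳ 0#)

  ∑-+ : (L : List I) (f g : I → C) → ∑ L (λ a → f a + g a) ≈ ∑ L f + ∑ L g
  ∑-+ []      f g = ≈-sym (+-identityʳ 0#)
  ∑-+ (a ∷ L) f g = ≈-trans (+-congˡ (∑-+ L f g))
    (solve 4 (λ x y X Y → (x :+ y) :+ (X :+ Y) := (x :+ X) :+ (y :+ Y)) ≈-refl (f a) (g a) (∑ L f) (∑ L g))

  ∑-*ˡ : (L : List I) (k : C) (f : I → C) → ∑ L (λ a → k * f a) ≈ k * ∑ L f
  ∑-*ˡ []      k f = ≈-sym (zeroʳ k)
  ∑-*ˡ (a ∷ L) k f = ≈-trans (+-congˡ (∑-*ˡ L k f)) (≈-sym (distribˡ k _ _))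

  ∑-comm : (L : List I) (M : List J) (F : I → J → C) →
    ∑ L (λ a → ∑ M (F a)) ≈ ∑ M (λ b → ∑ L (λ a → F a b))
  ∑-comm []      M F = ≈-sym (∑-0 M)
  ∑-comm (a ∷ L) M F = ≈-trans (+-congˡ (∑-comm L M F)) (≈-sym (∑-+ M (F a) _))

  ∑-concatMap : (h : I → List J) (L : List I) (g : J → C) →
    ∑ (concatMap h L) g ≈ ∑ L (λ a → ∑ (h a) g)
  ∑-concatMap h []      g = ≈-refl
  ∑-concatMap h (a ∷ L) g = ≈-trans (∑-++ (h a) (concatMap h L) g) (+-congˡ (∑-concatMap h L g))

  ∑-filter : {P : I → Set} (P? : ∀ a → Dec (P a)) (L : List I) (g : I → C) →
    ∑ (filter P? L) g ≈ ∑ L (λ a → if does (P? a) then g a else 0#)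
  ∑-filter P? []      g = ≈-refl
  ∑-filter P? (a ∷ L) g with does (P? a)
  ... | true  = +-congˡ (∑-filter P? L g)
  ... | false = ≈-trans (∑-filter P? L g) (≈-sym (+-identityˡ _))

  ∑-const : (L : List I) {f : I → C} (k : C) → All (λ a → f a ≈ k) L →
    ∑ L f ≈ natS (length L) * k
  ∑-const []      k []          = ≈-sym (zeroˡ k)
  ∑-const (a ∷ L) k (fa≈k ∷ r) = ≈-trans (+-cong fa≈k (∑-const L k r))
    (≈-sym (≈-trans (distribʳ k 1# _) (+-congʳ (*-identityˡ k))))

  ∑-triple : ∀ (g₁ g₂ g₃ : I → J) (L : List I) (G : J → C) →
    ∑ (concatMap (λ a → g₁ a ∷ g₂ a ∷ g₃ a ∷ []) L) G ≈
      ∑ L (λ a → G (g₁ a)) + (∑ L (λ a → G (g₂ a)) + ∑ L (λ a → G (g₃ a)))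
  ∑-triple g₁ g₂ g₃ L G = ≈-trans (∑-concatMap _ L G)
    (≈-trans (∑-cong L (λ a → +-congˡ (+-congˡ (+-identityʳ _))))
      (≈-trans (∑-+ L _ _) (+-congˡ (∑-+ L _ _))))

  rising-cong : ∀ {x y} m → x ≈ y → rising x m ≈ rising y m
  rising-cong zero    _   = ≈-refl
  rising-cong (suc m) x≈y = *-cong (rising-cong m x≈y) (+-congʳ x≈y)

  when : Bool → C → C
  when b x = if b then x else 0#

  when-cong : ∀ {b b′ x y} → b ≡ b′ → x ≈ y → when b x ≈ when b′ y
  when-cong {true}  refl x≈y = x≈y
  when-cong {false} refl _   = ≈-refl

  when-false : ∀ {b x} → b ≡ false → when b x ≈ 0#
  when-false refl = ≈-refl

  when-*ˡ : ∀ b k {x y} → x ≈ k * y → when b x ≈ k * when b y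
  when-*ˡ true  k x≈ky = x≈ky
  when-*ˡ false k _    = ≈-sym (zeroʳ k)

  lincomb : List (C × Labelled) → (Labelled → C) → C
  lincomb ks g = ∑ ks (λ kd → proj₁ kd * g (proj₂ kd))

  lincomb-cong : ∀ ks {g h} → (∀ d → g d ≈ h d) → lincomb ks g ≈ lincomb ks h
  lincomb-cong ks g≈h = ∑-cong ks (λ kd → *-congˡ (g≈h (proj₂ kd)))

  lincomb-+ : ∀ ks g h → lincomb ks (λ d → g d + h d) ≈ lincomb ks g + lincomb ks h
  lincomb-+ ks g h = ≈-trans (∑-cong ks (λ kd → distribˡ (proj₁ kd) _ _)) (∑-+ ks _ _)

  lincomb-*ˡ : ∀ ks k g → lincomb ks (λ d → k * g d) ≈ k * lincomb ks g
  lincomb-*ˡ ks k g = ≈-trans (∑-cong ks (λ kd → *-Props.x∙yz≈y∙xz (proj₁ kd) k _)) (∑-*ˡ ks k _)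

  lincomb-comm : ∀ ks ls (F : Labelled → Labelled → C) →
    lincomb ks (λ d → lincomb ls (F d)) ≈ lincomb ls (λ e → lincomb ks (λ d → F d e))
  lincomb-comm ks ls F = begin
    lincomb ks (λ d → lincomb ls (F d))
      ≈⟨ ∑-cong ks (λ kd → ≈-sym (∑-*ˡ ls (proj₁ kd) _)) ⟩
    ∑ ks (λ kd → ∑ ls (λ le → proj₁ kd * (proj₁ le * F (proj₂ kd) (proj₂ le))))
      ≈⟨ ∑-comm ks ls _ ⟩
    ∑ ls (λ le → ∑ ks (λ kd → proj₁ kd * (proj₁ le * F (proj₂ kd) (proj₂ le))))
      ≈⟨ ∑-cong ls (λ le → lincomb-*ˡ ks (proj₁ le) (λ d → F d (proj₂ le))) ⟩
    lincomb ls (λ e → lincomb ks (λ d → F d e)) ∎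

  ∑-completions-hole : ∀ ℓ tm (G : List Labelled → C) → ∑ (completions ((ℓ , false) ∷ tm)) G ≈
    ∑ (completions tm) (λ y → G ((ℓ , L0) ∷ y)) + ∑ (completions tm) (λ y → G ((ℓ , L2) ∷ y))
  ∑-completions-hole ℓ tm G = ≈-trans (∑-++ (map ((ℓ , L0) ∷_) (completions tm)) _ G)
    (reflexive (cong₂ _+_ (∑-map _ (completions tm) G) (∑-map _ (completions tm) G)))

  zOf : List ℕ → List C → ℕ → C
  zOf (o ∷ os) (z ∷ zs) b = if b ≡ᵇ o then z * zOf os zs b else zOf os zs b
  zOf _        _        _ = 1#

  zTile : List ℕ → List C → Tile → C
  zTile (o ∷ os) (z ∷ zs) t = if inStrip o t then z * zTile os zs t else zTile os zs t
  zTile _        _        _ = 1#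

  zOf-∉ : ∀ os zs b → All (λ o → (b ≡ᵇ o) ≡ false) os → zOf os zs b ≡ 1#
  zOf-∉ []       zs       b _            = refl
  zOf-∉ (o ∷ os) []       b _            = refl
  zOf-∉ (o ∷ os) (z ∷ zs) b (b≉o ∷ b∉os) rewrite b≉o = zOf-∉ os zs b b∉os

  zTile-square : ∀ os zs a l b l′ → All (λ o → (a ≡ᵇ o) ≡ false) os → All (λ o → (b ≡ᵇ o) ≡ false) os →
    zTile os zs (tile a l b l′) ≡ 1#
  zTile-square []       zs       a l b l′ _              _              = refl
  zTile-square (o ∷ os) []       a l b l′ _              _              = refl
  zTile-square (o ∷ os) (z ∷ zs) a l b l′ (a≉o ∷ a∉os) (b≉o ∷ b∉os) rewrite a≉o | b≉o =
    zTile-square os zs a l b l′ a∉os b∉os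

  zTile-tall : ∀ os zs a l b l′ → All (λ o → (a ≡ᵇ o) ≡ false) os → zTile os zs (tile a l b l′) ≡ zOf os zs b
  zTile-tall []       zs       a l b l′ _              = refl
  zTile-tall (o ∷ os) []       a l b l′ _              = refl
  zTile-tall (o ∷ os) (z ∷ zs) a l b l′ (a≉o ∷ a∉os) rewrite a≉o | zTile-tall os zs a l b l′ a∉os = refl

  zTile-short : ∀ os zs a l b l′ → All (λ o → (b ≡ᵇ o) ≡ false) os → zTile os zs (tile a l b l′) ≡ zOf os zs a
  zTile-short []       zs       a l b l′ _              = refl
  zTile-short (o ∷ os) []       a l b l′ _              = refl
  zTile-short (o ∷ os) (z ∷ zs) a l b l′ (b≉o ∷ b∉os)
    rewrite b≉o | ∨-identityʳ (a ≡ᵇ o) | zTile-short os zs a l b l′ b∉os = refl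

  zArrows : List ℕ → List C → List Tile → List Arrow → C
  zArrows os zs (t ∷ ts) (a ∷ f) = (if isArrow a then zTile os zs t else 1#) * zArrows os zs ts f
  zArrows os zs _        _       = 1#

  -- O lists the labels of the diagonal strips, zs their weights; zOf O zs ℓ is the weight of
  -- strip ℓ (1 if it is not diagonal) and zTile O zs t that of the diagonal strip through t.
  module Weights (α β : C) (O : List ℕ) (zs : List C) where

    z : ℕ → C
    z = zOf O zs

    zT : Tile → C
    zT = zTile O zs

    -- The fillings of ts compatible with σ, weighted by the free rows and columns among the letters of x.
    Zfill : List Labelled → Marks → List Tile → C
    Zfill x σ [] = pow α (countB (freeRow σ) x) * pow β (countB (freeColumn σ) x)
    Zfill x σ (t ∷ ts) = Zfill x σ ts +
      (when (upAllowed σ t) (zT t * Zfill x (placeUp t σ) ts) +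
       when (leftAllowed σ t) (zT t * Zfill x (placeLeft t σ) ts))

    Z : List Labelled → C
    Z x = Zfill x unmarked (tiling x)

    fillingWeight : List Labelled → Marks → List Tile → List Arrow → C
    fillingWeight x σ ts f =
      pow α (countB (freeRow (markAll ts f σ)) x) * pow β (countB (freeColumn (markAll ts f σ)) x) * zArrows O zs ts f

    fillingTerm : List Labelled → Marks → List Tile → List Arrow → C
    fillingTerm x σ ts f = when ((length f ≡ᵇ length ts) ∧ validFrom σ ts f) (fillingWeight x σ ts f)

    Zfill-fillings : ∀ x ts σ → ∑ (fillings (length ts)) (fillingTerm x σ ts) ≈ Zfill x σ ts
    Zfill-fillings x [] σ = ≈-trans (+-identityʳ _) (*-identityʳ _)
    Zfill-fillings x (t ∷ ts) σ =
      ≈-trans (∑-triple (none ∷_) (up ∷_) (left ∷_) F (fillingTerm x σ (t ∷ ts)))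
        (+-cong no-arrow (+-cong (arrow up refl) (arrow left refl)))
      where
      F = fillings (length ts)
      no-arrow : ∑ F (λ f → fillingTerm x σ (t ∷ ts) (none ∷ f)) ≈ Zfill x σ ts
      no-arrow = ≈-trans (∑-cong F (λ f → when-cong refl (*-congˡ (*-identityˡ _)))) (Zfill-fillings x ts σ)
      arrow : ∀ a → isArrow a ≡ true →
        ∑ F (λ f → fillingTerm x σ (t ∷ ts) (a ∷ f)) ≈ when (arrowOk σ t a) (zT t * Zfill x (markArrow t a σ) ts)
      arrow a a-arrow with arrowOk σ t a
      ... | true = ≈-trans (∑-cong F (λ f → when-*ˡ ((length f ≡ᵇ length ts) ∧ validFrom (markArrow t a σ) ts f)
                                                     (zT t) (factor f)))
                     (≈-trans (∑-*ˡ F (zT t) _) (*-congˡ (Zfill-fillings x ts (markArrow t a σ))))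
        where
        factor : ∀ f → fillingWeight x σ (t ∷ ts) (a ∷ f) ≈ zT t * fillingWeight x (markArrow t a σ) ts f
        factor f = ≈-trans (*-congˡ (*-congʳ (reflexive (cong (λ b → if b then zT t else 1#) a-arrow))))
          (solve 4 (λ p q w r → p :* q :* (w :* r) := w :* (p :* q :* r)) ≈-refl _ _ (zT t) (zArrows O zs ts f))
      ... | false = ≈-trans (∑-cong F (λ f → when-false (∧-zeroʳ (length f ≡ᵇ length ts)))) (∑-0 F)

    Zfill-↭ : ∀ {x y} → x ↭ y → ∀ σ ts → Zfill x σ ts ≡ Zfill y σ ts
    Zfill-↭ x↭y σ [] rewrite countB-↭ (freeRow σ) x↭y | countB-↭ (freeColumn σ) x↭y = refl
    Zfill-↭ x↭y σ (t ∷ ts)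
      rewrite Zfill-↭ x↭y σ ts | Zfill-↭ x↭y (placeUp t σ) ts | Zfill-↭ x↭y (placeLeft t σ) ts = refl

    Zfill-deleteStrip : ∀ a x σ σ′ ts → StripBlocked a σ σ′ →
      All (λ e → (label e ≡ᵇ a) ≡ true → NotFree σ e) x → All (SameFree σ σ′) (deleteLabel a x) →
      Zfill x σ ts ≈ Zfill (deleteLabel a x) σ′ (dropStrip a ts)
    Zfill-deleteStrip a x σ σ′ [] _ notFree sameFree =
      reflexive (cong₂ (λ m n → pow α m * pow β n)
        (trans (countB-deleteLabel (freeRow σ) a x (All.map (λ h eq → proj₁ (h eq)) notFree))
               (countB-congᴬ (All.map proj₁ sameFree)))
        (trans (countB-deleteLabel (freeColumn σ) a x (All.map (λ h eq → proj₂ (h eq)) notFree))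
               (countB-congᴬ (All.map proj₂ sameFree))))
    Zfill-deleteStrip a x σ σ′ (t ∷ ts) a-blocked notFree sameFree with inStrip a t in t∈a
    ... | true = ≈-trans
      (+-congˡ (≈-trans (+-cong (when-false up-off) (when-false left-off)) (+-identityˡ 0#)))
      (≈-trans (+-identityʳ _) (Zfill-deleteStrip a x σ σ′ ts a-blocked notFree sameFree))
      where
      t-blocked = isBlocked-inStrip a σ σ′ t a-blocked t∈a
      up-off : upAllowed σ t ≡ false
      up-off = trans (cong (λ b → (let₂ t =ᴸ L0) ∧ not b) t-blocked) (∧-zeroʳ _)
      left-off : leftAllowed σ t ≡ false
      left-off = trans (cong (λ b → (let₁ t =ᴸ L2) ∧ not b) t-blocked) (∧-zeroʳ _)
    ... | false =
      +-cong (Zfill-deleteStrip a x σ σ′ ts a-blocked notFree sameFree)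
        (+-cong (when-cong (cong (λ b → _ ∧ not b) same-block)
                  (*-congˡ (Zfill-deleteStrip a x (placeUp t σ) (placeUp t σ′) ts
                              (StripBlocked-placeUp a t σ σ′ a-blocked)
                              (All.map (λ h eq → NotFree-placeUp t σ (h eq)) notFree)
                              (All.map (SameFree-placeUp t σ σ′) sameFree))))
                (when-cong (cong (λ b → _ ∧ not b) same-block)
                  (*-congˡ (Zfill-deleteStrip a x (placeLeft t σ) (placeLeft t σ′) ts
                              (StripBlocked-placeLeft a t σ σ′ a-blocked)
                              (All.map (λ h eq → NotFree-placeLeft t σ (h eq)) notFree)
                              (All.map (SameFree-placeLeft t σ σ′) sameFree)))))
      where same-block = isBlocked-offStrip a σ σ′ t a-blocked t∈a

    Z-firstDescent-unfold : ∀ p f g q → Sorted (p ++ [ f ]) → (f ≻ g) ≡ true →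
      Z (p ++ f ∷ g ∷ q) ≡ Z (p ++ g ∷ f ∷ q) +
        (when (upAllowed unmarked (tileOf f g))
           (zT (tileOf f g) * Zfill (p ++ g ∷ f ∷ q) (placeUp (tileOf f g) unmarked) (tiling (p ++ g ∷ f ∷ q))) +
         when (leftAllowed unmarked (tileOf f g))
           (zT (tileOf f g) * Zfill (p ++ g ∷ f ∷ q) (placeLeft (tileOf f g) unmarked) (tiling (p ++ g ∷ f ∷ q))))
    Z-firstDescent-unfold p f g q s f≻g
      rewrite tiling-descent p f g q s f≻g
            | Zfill-↭ (↭-swapAt p f g q) unmarked (tiling (p ++ g ∷ f ∷ q))
            | Zfill-↭ (↭-swapAt p f g q) (placeUp (tileOf f g) unmarked) (tiling (p ++ g ∷ f ∷ q))
            | Zfill-↭ (↭-swapAt p f g q) (placeLeft (tileOf f g) unmarked) (tiling (p ++ g ∷ f ∷ q)) = refl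

    Z-deleteStrip : ∀ a x σ → StripBlocked a σ unmarked → All (λ e → (label e ≡ᵇ a) ≡ true → NotFree σ e) x →
      All (SameFree σ unmarked) (deleteLabel a x) → Zfill x σ (tiling x) ≈ Z (deleteLabel a x)
    Z-deleteStrip a x σ a-blocked notFree sameFree =
      ≈-trans (Zfill-deleteStrip a x σ unmarked (tiling x) a-blocked notFree sameFree)
              (reflexive (cong (Zfill (deleteLabel a x) unmarked) (sym (tiling-deleteLabel a x))))

    -- A left-arrow in the first tile blocks its row for good and makes it non-free: the row disappears.
    Z-leftArrow : ∀ p a b l q → DistinctAt p (a , L2) (b , l) q → (l =ᴸ L2) ≡ false →
      Zfill (p ++ (b , l) ∷ (a , L2) ∷ q) (placeLeft (tile a L2 b l) unmarked) (tiling (p ++ (b , l) ∷ (a , L2) ∷ q))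
        ≈ Z (p ++ (b , l) ∷ q)
    Z-leftArrow p a b l q d l≢2 = begin
      Zfill x′ σ (tiling x′)
        ≈⟨ Z-deleteStrip a x′ σ (λ _ → refl) notFree (subst (All (SameFree σ unmarked)) (sym deleted) same) ⟩
      Z (deleteLabel a x′)
        ≡⟨ cong Z deleted ⟩
      Z (p ++ (b , l) ∷ q) ∎
      where
      open DistinctAt d
      t  = tile a L2 b l
      σ  = placeLeft t unmarked
      x′ = p ++ (b , l) ∷ (a , L2) ∷ q
      deleted = deleteLabel-second p (a , L2) (b , l) q d
      row-a : NotFree σ (a , L2)
      row-a rewrite ≡ᵇ-refl a = refl , refl
      notFree : All (λ e → (label e ≡ᵇ a) ≡ true → NotFree σ e) x′
      notFree = All.++⁺ (∉labels-vacuous a p f∉p)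
        ((λ b≈a → true≢false (trans (sym b≈a) g≉f)) ∷ (λ _ → row-a) ∷ ∉labels-vacuous a q f∉q)
      row-b : SameFree σ unmarked (b , l)
      row-b rewrite l≢2 = refl , refl
      same : All (SameFree σ unmarked) (p ++ (b , l) ∷ q)
      same = All.++⁺ (proj₁ (SameFree-offTile t unmarked p f∉p g∉p))
                     (row-b ∷ proj₁ (SameFree-offTile t unmarked q f∉q g∉q))

    Z-upArrow : ∀ p a l b q → DistinctAt p (a , l) (b , L0) q → (l =ᴸ L0) ≡ false →
      Zfill (p ++ (b , L0) ∷ (a , l) ∷ q) (placeUp (tile a l b L0) unmarked) (tiling (p ++ (b , L0) ∷ (a , l) ∷ q))
        ≈ Z (p ++ (a , l) ∷ q)
    Z-upArrow p a l b q d l≢0 = begin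
      Zfill x′ σ (tiling x′)
        ≈⟨ Z-deleteStrip b x′ σ (λ _ → refl) notFree (subst (All (SameFree σ unmarked)) (sym deleted) same) ⟩
      Z (deleteLabel b x′)
        ≡⟨ cong Z deleted ⟩
      Z (p ++ (a , l) ∷ q) ∎
      where
      open DistinctAt d
      t  = tile a l b L0
      σ  = placeUp t unmarked
      x′ = p ++ (b , L0) ∷ (a , l) ∷ q
      deleted = deleteLabel-first p (a , l) (b , L0) q d
      column-b : NotFree σ (b , L0)
      column-b rewrite ≡ᵇ-refl b | f≉g = refl , refl
      notFree : All (λ e → (label e ≡ᵇ b) ≡ true → NotFree σ e) x′
      notFree = All.++⁺ (∉labels-vacuous b p g∉p)
        ((λ _ → column-b) ∷ (λ a≈b → true≢false (trans (sym a≈b) f≉g)) ∷ ∉labels-vacuous b q g∉q)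
      column-a : SameFree σ unmarked (a , l)
      column-a rewrite l≢0 = refl , refl
      same : All (SameFree σ unmarked) (p ++ (a , l) ∷ q)
      same = All.++⁺ (proj₂ (SameFree-offTile t unmarked p f∉p g∉p))
                     (column-a ∷ proj₂ (SameFree-offTile t unmarked q f∉q g∉q))

    OffDiagonal : ℕ → Set
    OffDiagonal ℓ = All (λ o → (ℓ ≡ᵇ o) ≡ false) O

    Compatible : Labelled → Set
    Compatible e = letter e ≡ L1 ⊎ OffDiagonal (label e)

    Admissible : List Labelled → Set
    Admissible x = Distinct x × All Compatible x

    admissible-↭ : ∀ {x y} → x ↭ y → Admissible x → Admissible y
    admissible-↭ x↭y (d , c) =
      AllPairs-resp-↭ (λ {a} {b} h → trans (≡ᵇ-sym (label a) (label b)) h) x↭y d , All-resp-↭ x↭y c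

    admissible-⊆ : ∀ {x y} → x ⊆ y → Admissible y → Admissible x
    admissible-⊆ x⊆y (d , c) = AllPairs-resp-⊆ x⊆y d , All-resp-⊆ x⊆y c

    offDiagonal : ∀ e → letter e ≢ L1 → Compatible e → OffDiagonal (label e)
    offDiagonal _ l≢1 (inj₁ l≡1) = ⊥-elim (l≢1 l≡1)
    offDiagonal _ _   (inj₂ a∉O) = a∉O

    compatible-middle : ∀ p f g q → Admissible (p ++ f ∷ g ∷ q) → Compatible f × Compatible g
    compatible-middle p f g q (_ , c) with All.++⁻ʳ p c
    ... | cf ∷ cg ∷ _ = cf , cg

    -- Z (p f g q) = Z (p g f q) + Σ k Z (p d q) over (k , d) ∈ descentTerms f g, for f ≻ g
    descentTerms : Labelled → Labelled → List (C × Labelled)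
    descentTerms (a , L2) (b , L1) = (z b , (b , L1)) ∷ []
    descentTerms (a , L2) (b , L0) = (1# , (a , L2)) ∷ (1# , (b , L0)) ∷ []
    descentTerms (a , L1) (b , L0) = (z a , (a , L1)) ∷ []
    descentTerms _        _        = []

    Zinsert : List (C × Labelled) → List Labelled → List Labelled → C
    Zinsert ks p q = lincomb ks (λ d → Z (p ++ d ∷ q))

    Z-firstDescent : ∀ p f g q → Admissible (p ++ f ∷ g ∷ q) → Sorted (p ++ [ f ]) → (f ≻ g) ≡ true →
      Z (p ++ f ∷ g ∷ q) ≈ Z (p ++ g ∷ f ∷ q) + Zinsert (descentTerms f g) p q
    Z-firstDescent p (a , L2) (b , L1) q adm s f≻g = begin
      Z (p ++ (a , L2) ∷ (b , L1) ∷ q)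
        ≡⟨ Z-firstDescent-unfold p (a , L2) (b , L1) q s f≻g ⟩
      Z x′ + (0# + zT t * Zfill x′ (placeLeft t unmarked) (tiling x′))
        ≈⟨ +-congˡ (≈-trans (+-identityˡ _) (*-cong (reflexive zT≡z) (Z-leftArrow p a b L1 q d refl))) ⟩
      Z x′ + z b * Z (p ++ (b , L1) ∷ q)
        ≈⟨ +-congˡ (≈-sym (+-identityʳ _)) ⟩
      Z x′ + Zinsert (descentTerms (a , L2) (b , L1)) p q ∎
      where
      t  = tile a L2 b L1
      x′ = p ++ (b , L1) ∷ (a , L2) ∷ q
      d  = distinctAt p (a , L2) (b , L1) q (proj₁ adm)
      zT≡z = zTile-tall O zs a L2 b L1 (offDiagonal (a , L2) (λ ()) (proj₁ (compatible-middle p _ _ q adm)))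
    Z-firstDescent p (a , L2) (b , L0) q adm s f≻g = begin
      Z (p ++ (a , L2) ∷ (b , L0) ∷ q)
        ≡⟨ Z-firstDescent-unfold p (a , L2) (b , L0) q s f≻g ⟩
      Z x′ + (zT t * Zfill x′ (placeUp t unmarked) (tiling x′) + zT t * Zfill x′ (placeLeft t unmarked) (tiling x′))
        ≈⟨ +-congˡ (+-cong (*-cong (reflexive zT≡1) (Z-upArrow p a L2 b q d refl))
                            (*-cong (reflexive zT≡1) (Z-leftArrow p a b L0 q d refl))) ⟩
      Z x′ + (1# * Z (p ++ (a , L2) ∷ q) + 1# * Z (p ++ (b , L0) ∷ q))
        ≈⟨ +-congˡ (+-congˡ (≈-sym (+-identityʳ _))) ⟩
      Z x′ + Zinsert (descentTerms (a , L2) (b , L0)) p q ∎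
      where
      t  = tile a L2 b L0
      x′ = p ++ (b , L0) ∷ (a , L2) ∷ q
      d  = distinctAt p (a , L2) (b , L0) q (proj₁ adm)
      zT≡1 = zTile-square O zs a L2 b L0 (offDiagonal (a , L2) (λ ()) (proj₁ (compatible-middle p _ _ q adm)))
                                          (offDiagonal (b , L0) (λ ()) (proj₂ (compatible-middle p _ _ q adm)))
    Z-firstDescent p (a , L1) (b , L0) q adm s f≻g = begin
      Z (p ++ (a , L1) ∷ (b , L0) ∷ q)
        ≡⟨ Z-firstDescent-unfold p (a , L1) (b , L0) q s f≻g ⟩
      Z x′ + (zT t * Zfill x′ (placeUp t unmarked) (tiling x′) + 0#)
        ≈⟨ +-congˡ (+-congʳ (*-cong (reflexive zT≡z) (Z-upArrow p a L1 b q d refl))) ⟩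
      Z x′ + Zinsert (descentTerms (a , L1) (b , L0)) p q ∎
      where
      t  = tile a L1 b L0
      x′ = p ++ (b , L0) ∷ (a , L1) ∷ q
      d  = distinctAt p (a , L1) (b , L0) q (proj₁ adm)
      zT≡z = zTile-short O zs a L1 b L0 (offDiagonal (b , L0) (λ ()) (proj₂ (compatible-middle p _ _ q adm)))
    Z-firstDescent p (a , L0) (b , _)  q _ _ ()
    Z-firstDescent p (a , L1) (b , L1) q _ _ ()
    Z-firstDescent p (a , L1) (b , L2) q _ _ ()
    Z-firstDescent p (a , L2) (b , L2) q _ _ ()

    RelationAt : List Labelled → Labelled → Labelled → List Labelled → Set ℓ
    RelationAt u f g v = Z (u ++ f ∷ g ∷ v) ≈ Z (u ++ g ∷ f ∷ v) + Zinsert (descentTerms f g) u v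

    RelationAfter : List Labelled → List Labelled → Labelled → Labelled → List Labelled → Set ℓ
    RelationAfter p w f g v =
      Z (p ++ w ++ f ∷ g ∷ v) ≈ Z (p ++ w ++ g ∷ f ∷ v) + lincomb (descentTerms f g) (λ d → Z (p ++ w ++ d ∷ v))

    RelationBelow : ℕ → Set ℓ
    RelationBelow n = ∀ u f g v → inversions (u ++ f ∷ g ∷ v) < n →
      Admissible (u ++ f ∷ g ∷ v) → (f ≻ g) ≡ true → RelationAt u f g v

    Z-assoc : ∀ p w y → Z ((p ++ w) ++ y) ≈ Z (p ++ w ++ y)
    Z-assoc p w y = reflexive (cong Z (List.++-assoc p w y))

    Zinsert-assoc : ∀ p w f g v → lincomb (descentTerms f g) (λ d → Z ((p ++ w) ++ d ∷ v)) ≈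
      lincomb (descentTerms f g) (λ d → Z (p ++ w ++ d ∷ v))
    Zinsert-assoc p w f g v = lincomb-cong (descentTerms f g) (λ d → Z-assoc p w (d ∷ v))

    RelationAt⇒After : ∀ p w f g v → RelationAt (p ++ w) f g v → RelationAfter p w f g v
    RelationAt⇒After p w f g v rel = ≈-trans (≈-sym (Z-assoc p w (f ∷ g ∷ v)))
      (≈-trans rel (+-cong (Z-assoc p w (g ∷ f ∷ v)) (Zinsert-assoc p w f g v)))

    RelationAfter⇒At : ∀ p w f g v → RelationAfter p w f g v → RelationAt (p ++ w) f g v
    RelationAfter⇒At p w f g v rel = ≈-trans (Z-assoc p w (f ∷ g ∷ v))
      (≈-trans rel (≈-sym (+-cong (Z-assoc p w (g ∷ f ∷ v)) (Zinsert-assoc p w f g v))))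

    RelationBelow⇒After : ∀ {n} → RelationBelow n → ∀ p w f g v → inversions (p ++ w ++ f ∷ g ∷ v) < n →
      Admissible (p ++ w ++ f ∷ g ∷ v) → (f ≻ g) ≡ true → RelationAfter p w f g v
    RelationBelow⇒After below p w f g v lt adm f≻g = RelationAt⇒After p w f g v
      (below (p ++ w) f g v (subst (_< _) (cong inversions assoc) lt) (subst Admissible assoc adm) f≻g)
      where assoc = sym (List.++-assoc p w (f ∷ g ∷ v))

    descentTerms-cong : ∀ f g {F G : Labelled → C} → F f ≈ G f → F g ≈ G g →
      lincomb (descentTerms f g) F ≈ lincomb (descentTerms f g) G
    descentTerms-cong (a , L2) (b , L1) _     Fg≈Gg = +-congʳ (*-congˡ Fg≈Gg)
    descentTerms-cong (a , L2) (b , L0) Ff≈Gf Fg≈Gg = +-cong (*-congˡ Ff≈Gf) (+-congʳ (*-congˡ Fg≈Gg))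
    descentTerms-cong (a , L1) (b , L0) Ff≈Gf _     = +-congʳ (*-congˡ Ff≈Gf)
    descentTerms-cong (a , L0) _        _     _     = ≈-refl
    descentTerms-cong (a , L1) (b , L1) _     _     = ≈-refl
    descentTerms-cong (a , L1) (b , L2) _     _     = ≈-refl
    descentTerms-cong (a , L2) (b , L2) _     _     = ≈-refl

    -- The first descent g₁ g₂ lies strictly before f₁ f₂: the two relations commute.
    Z-descent-disjoint : ∀ p g₁ g₂ q f₁ f₂ v → RelationBelow (inversions (p ++ g₁ ∷ g₂ ∷ q ++ f₁ ∷ f₂ ∷ v)) →
      Admissible (p ++ g₁ ∷ g₂ ∷ q ++ f₁ ∷ f₂ ∷ v) → Sorted (p ++ [ g₁ ]) → (g₁ ≻ g₂) ≡ true → (f₁ ≻ f₂) ≡ true →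
      RelationAfter p (g₁ ∷ g₂ ∷ q) f₁ f₂ v
    Z-descent-disjoint p g₁ g₂ q f₁ f₂ v below adm s g₁≻g₂ f₁≻f₂ = begin
      Z (p ++ g₁ ∷ g₂ ∷ r₁)
        ≈⟨ Z-firstDescent p g₁ g₂ r₁ adm s g₁≻g₂ ⟩
      Z (p ++ g₂ ∷ g₁ ∷ r₁) + Zinsert tg p r₁
        ≈⟨ +-cong swapped dropped ⟩
      (Z (p ++ g₂ ∷ g₁ ∷ r₂) + after (g₂ ∷ g₁ ∷ q)) + (Zinsert tg p r₂ + mixed)
        ≈⟨ +-Props.interchange _ _ _ _ ⟩
      (Z (p ++ g₂ ∷ g₁ ∷ r₂) + Zinsert tg p r₂) + (after (g₂ ∷ g₁ ∷ q) + mixed)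
        ≈⟨ ≈-sym (+-cong (Z-firstDescent p g₁ g₂ r₂ adm₂ s g₁≻g₂) later) ⟩
      Z (p ++ g₁ ∷ g₂ ∷ r₂) + after (g₁ ∷ g₂ ∷ q) ∎
      where
      tg = descentTerms g₁ g₂
      tf = descentTerms f₁ f₂
      r₁ = q ++ f₁ ∷ f₂ ∷ v
      r₂ = q ++ f₂ ∷ f₁ ∷ v
      after : List Labelled → C
      after w = lincomb tf (λ e → Z (p ++ w ++ e ∷ v))
      mixed = lincomb tf (λ e → Zinsert tg p (q ++ e ∷ v))
      adm₂ = admissible-↭ (++⁺ˡ p (↭-swapAt (g₁ ∷ g₂ ∷ q) f₁ f₂ v)) adm
      swapped : Z (p ++ g₂ ∷ g₁ ∷ r₁) ≈ Z (p ++ g₂ ∷ g₁ ∷ r₂) + after (g₂ ∷ g₁ ∷ q)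
      swapped = RelationBelow⇒After below p (g₂ ∷ g₁ ∷ q) f₁ f₂ v (inversions-swap-< p g₁ g₂ r₁ g₁≻g₂)
        (admissible-↭ (↭-swapAt p g₁ g₂ r₁) adm) f₁≻f₂
      dropped : Zinsert tg p r₁ ≈ Zinsert tg p r₂ + mixed
      dropped = begin
        Zinsert tg p r₁
          ≈⟨ descentTerms-cong g₁ g₂
               (RelationBelow⇒After below p (g₁ ∷ q) f₁ f₂ v (proj₁ (inversions-drop p g₁ g₂ r₁ g₁≻g₂))
                 (admissible-⊆ (⊆-dropSecond p g₁ g₂ r₁) adm) f₁≻f₂)
               (RelationBelow⇒After below p (g₂ ∷ q) f₁ f₂ v (proj₂ (inversions-drop p g₁ g₂ r₁ g₁≻g₂))
                 (admissible-⊆ (⊆-dropAt p g₁ (g₂ ∷ r₁)) adm) f₁≻f₂) ⟩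
        lincomb tg (λ d → Z (p ++ d ∷ r₂) + lincomb tf (λ e → Z (p ++ d ∷ q ++ e ∷ v)))
          ≈⟨ lincomb-+ tg _ _ ⟩
        Zinsert tg p r₂ + lincomb tg (λ d → lincomb tf (λ e → Z (p ++ d ∷ q ++ e ∷ v)))
          ≈⟨ +-congˡ (lincomb-comm tg tf _) ⟩
        Zinsert tg p r₂ + mixed ∎
      later : after (g₁ ∷ g₂ ∷ q) ≈ after (g₂ ∷ g₁ ∷ q) + mixed
      later = ≈-trans
        (descentTerms-cong f₁ f₂
          (Z-firstDescent p g₁ g₂ (q ++ f₁ ∷ v)
            (admissible-⊆ (++⁺ ⊆-refl (⊆-dropSecond (g₁ ∷ g₂ ∷ q) f₁ f₂ v)) adm) s g₁≻g₂)
          (Z-firstDescent p g₁ g₂ (q ++ f₂ ∷ v)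
            (admissible-⊆ (++⁺ ⊆-refl (⊆-dropAt (g₁ ∷ g₂ ∷ q) f₁ (f₂ ∷ v))) adm) s g₁≻g₂))
        (lincomb-+ tf _ _)

    -- The first descent r d overlaps the descent d k of the letters 2 1 0: both sides of the
    -- relation at d k expand, by relations at other positions, into the same combination of
    -- Z (p k d r v), Z (p d r v), Z (p k d v) and Z (p d v).
    module Overlap (p v : List Labelled) (F E G : ℕ)
      (below : RelationBelow (inversions (p ++ (F , L2) ∷ (E , L1) ∷ (G , L0) ∷ v)))
      (adm : Admissible (p ++ (F , L2) ∷ (E , L1) ∷ (G , L0) ∷ v)) (s : Sorted (p ++ [ (F , L2) ])) where

      r d k : Labelled
      r = (F , L2)
      d = (E , L1)
      k = (G , L0)

      drk< : inversions (p ++ d ∷ r ∷ k ∷ v) < inversions (p ++ r ∷ d ∷ k ∷ v)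
      drk< = inversions-swap-< p r d (k ∷ v) refl

      adm-drk : Admissible (p ++ d ∷ r ∷ k ∷ v)
      adm-drk = admissible-↭ (↭-swapAt p r d (k ∷ v)) adm

      adm-rkd : Admissible (p ++ r ∷ k ∷ d ∷ v)
      adm-rkd = admissible-↭ (++⁺ˡ p (↭-swapAt [ r ] d k v)) adm

      dk : Z (p ++ d ∷ k ∷ v) ≈ Z (p ++ k ∷ d ∷ v) + (z E * Z (p ++ d ∷ v) + 0#)
      dk = below p d k v (ℕ.≤-<-trans (inversions-deleteʳ p [ d ] r (k ∷ v)) drk<)
        (admissible-⊆ (⊆-dropSecond p d r (k ∷ v)) adm-drk) refl

      rd : Z (p ++ r ∷ d ∷ v) ≈ Z (p ++ d ∷ r ∷ v) + (z E * Z (p ++ d ∷ v) + 0#)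
      rd = Z-firstDescent p r d v (admissible-⊆ (++⁺ ⊆-refl (⊆-dropSecond [ r ] d k v)) adm) s refl

      lhs-expanded : Z (p ++ r ∷ d ∷ k ∷ v) ≈
        ((Z (p ++ k ∷ d ∷ r ∷ v) + (z E * Z (p ++ d ∷ r ∷ v) + 0#)) +
          (1# * Z (p ++ d ∷ r ∷ v) + (1# * (Z (p ++ k ∷ d ∷ v) + (z E * Z (p ++ d ∷ v) + 0#)) + 0#))) +
        (z E * (Z (p ++ k ∷ d ∷ v) + (z E * Z (p ++ d ∷ v) + 0#)) + 0#)
      lhs-expanded = ≈-trans (Z-firstDescent p r d (k ∷ v) adm s refl)
        (+-cong (≈-trans drk (+-cong dkr (+-congˡ (+-congʳ (*-congˡ dk))))) (+-congʳ (*-congˡ dk)))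
        where
        drk = RelationBelow⇒After below p [ d ] r k v drk< adm-drk refl
        dkr = below p d k (r ∷ v) (ℕ.<-trans (inversions-swap-<ʳ p [ d ] r k v refl) drk<)
          (admissible-↭ (++⁺ˡ p (↭-swapAt [ d ] r k v)) adm-drk) refl

      rhs-expanded : Z (p ++ r ∷ k ∷ d ∷ v) + (z E * Z (p ++ r ∷ d ∷ v) + 0#) ≈
        ((Z (p ++ k ∷ d ∷ r ∷ v) + (z E * Z (p ++ k ∷ d ∷ v) + 0#)) +
          (1# * (Z (p ++ d ∷ r ∷ v) + (z E * Z (p ++ d ∷ v) + 0#)) + (1# * Z (p ++ k ∷ d ∷ v) + 0#))) +
        (z E * (Z (p ++ d ∷ r ∷ v) + (z E * Z (p ++ d ∷ v) + 0#)) + 0#)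
      rhs-expanded = ≈-trans (+-congʳ (Z-firstDescent p r k (d ∷ v) adm-rkd s refl))
        (+-cong (+-cong krd (+-congʳ (*-congˡ rd))) (+-congʳ (*-congˡ rd)))
        where
        krd = RelationBelow⇒After below p [ k ] r d v
          (ℕ.<-trans (inversions-swap-< p r k (d ∷ v) refl) (inversions-swap-<ʳ p [ r ] d k v refl))
          (admissible-↭ (↭-swapAt p r k (d ∷ v)) adm-rkd) refl

      relation : RelationAfter p [ r ] d k v
      relation = ≈-trans lhs-expanded (≈-trans
        (solve 7 (λ a b c d z o n →
             ((a :+ (z :* b :+ n)) :+ (o :* b :+ (o :* (c :+ (z :* d :+ n)) :+ n))) :+ (z :* (c :+ (z :* d :+ n)) :+ n)
          := ((a :+ (z :* c :+ n)) :+ (o :* (b :+ (z :* d :+ n)) :+ (o :* c :+ n))) :+ (z :* (b :+ (z :* d :+ n)) :+ n))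
          ≈-refl (Z (p ++ k ∷ d ∷ r ∷ v)) (Z (p ++ d ∷ r ∷ v)) (Z (p ++ k ∷ d ∷ v)) (Z (p ++ d ∷ v)) (z E) 1# 0#)
        (≈-sym rhs-expanded))

    Z-descent-overlap : ∀ p e f g v → RelationBelow (inversions (p ++ e ∷ f ∷ g ∷ v)) →
      Admissible (p ++ e ∷ f ∷ g ∷ v) → Sorted (p ++ [ e ]) → (e ≻ f) ≡ true → (f ≻ g) ≡ true →
      RelationAfter p [ e ] f g v
    Z-descent-overlap p (F , L2) (E , L1) (G , L0) v below adm s _ _ = Overlap.relation p v F E G below adm s
    Z-descent-overlap p (_ , L0) (_ , _)  _        v _ _ _ () _
    Z-descent-overlap p (_ , L1) (_ , L0) _        v _ _ _ _ ()
    Z-descent-overlap p (_ , L1) (_ , L1) _        v _ _ _ () _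
    Z-descent-overlap p (_ , L1) (_ , L2) _        v _ _ _ () _
    Z-descent-overlap p (_ , L2) (_ , L2) _        v _ _ _ () _
    Z-descent-overlap p (_ , L2) (_ , L0) _        v _ _ _ _ ()
    Z-descent-overlap p (_ , L2) (_ , L1) (_ , L1) v _ _ _ _ ()
    Z-descent-overlap p (_ , L2) (_ , L1) (_ , L2) v _ _ _ _ ()

    Z-descent-step : ∀ u f g v → RelationBelow (inversions (u ++ f ∷ g ∷ v)) →
      Admissible (u ++ f ∷ g ∷ v) → (f ≻ g) ≡ true → RelationAt u f g v
    Z-descent-step u f g v below adm f≻g with firstDescentʳ u f
    ... | sorted s = Z-firstDescent u f g v adm s f≻g
    ... | inside p g₁ g₂ q refl s g₁≻g₂ = RelationAfter⇒At p (g₁ ∷ g₂ ∷ q) f g v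
      (Z-descent-disjoint p g₁ g₂ q f g v (subst RelationBelow (cong inversions assoc) below)
        (subst Admissible assoc adm) s g₁≻g₂ f≻g)
      where assoc = List.++-assoc p (g₁ ∷ g₂ ∷ q) (f ∷ g ∷ v)
    ... | atEnd p e refl s e≻f = RelationAfter⇒At p [ e ] f g v
      (Z-descent-overlap p e f g v (subst RelationBelow (cong inversions assoc) below)
        (subst Admissible assoc adm) s e≻f f≻g)
      where assoc = List.++-assoc p [ e ] (f ∷ g ∷ v)

    relationBelow : ∀ n → RelationBelow n
    relationBelow zero    u f g v ()
    relationBelow (suc n) u f g v (s≤s i≤n) = Z-descent-step u f g v
      (λ u′ f′ g′ v′ i′<i → relationBelow n u′ f′ g′ v′ (ℕ.<-≤-trans i′<i i≤n))

    Z-descent : ∀ u f g v → Admissible (u ++ f ∷ g ∷ v) → (f ≻ g) ≡ true → RelationAt u f g v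
    Z-descent u f g v = relationBelow (suc (inversions (u ++ f ∷ g ∷ v))) u f g v ℕ.≤-refl

    Z-sorted : ∀ x → Sorted x →
      Z x ≡ pow α (countB (freeRow unmarked) x) * pow β (countB (freeColumn unmarked) x)
    Z-sorted x s = cong (Zfill x unmarked) (tiling-sorted x s)

    -- Both sides obey the recursion of Z-firstDescent; induction on the inversions.
    Z-transfer : (F : List Labelled → List Labelled) (κ : C) →
      (∀ {x y} → x ↭ y → F x ↭ F y) → (∀ {x y} → x ⊆ y → F x ⊆ F y) →
      (∀ x → Sorted x → Z (F x) ≈ κ * Z x) →
      (∀ p f g q → Admissible (F (p ++ f ∷ g ∷ q)) → (f ≻ g) ≡ true →
         Z (F (p ++ f ∷ g ∷ q)) ≈ Z (F (p ++ g ∷ f ∷ q)) + lincomb (descentTerms f g) (λ d → Z (F (p ++ d ∷ q)))) →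
      ∀ x → Admissible x → Admissible (F x) → Z (F x) ≈ κ * Z x
    Z-transfer F κ F-↭ F-⊆ sorted-case relation = inversions-rec P go
      where
      P : List Labelled → Set ℓ
      P x = Admissible x → Admissible (F x) → Z (F x) ≈ κ * Z x
      go : ∀ x → (∀ y → inversions y < inversions x → P y) → P x
      go x ih adm admF with firstDescent x
      ... | sorted s = sorted-case x s
      ... | descent p f g q refl s f≻g = begin
        Z (F (p ++ f ∷ g ∷ q))
          ≈⟨ relation p f g q admF f≻g ⟩
        Z (F (p ++ g ∷ f ∷ q)) + lincomb tf (λ d → Z (F (p ++ d ∷ q)))
          ≈⟨ +-cong (ih _ (inversions-swap-< p f g q f≻g) (admissible-↭ swap adm) (admissible-↭ (F-↭ swap) admF))
                    (descentTerms-cong f g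
                      (ih _ (proj₁ (inversions-drop p f g q f≻g)) (admissible-⊆ drop₂ adm) (admissible-⊆ (F-⊆ drop₂) admF))
                      (ih _ (proj₂ (inversions-drop p f g q f≻g)) (admissible-⊆ drop₁ adm) (admissible-⊆ (F-⊆ drop₁) admF))) ⟩
        κ * Z (p ++ g ∷ f ∷ q) + lincomb tf (λ d → κ * Z (p ++ d ∷ q))
          ≈⟨ +-congˡ (lincomb-*ˡ tf κ _) ⟩
        κ * Z (p ++ g ∷ f ∷ q) + κ * Zinsert tf p q
          ≈⟨ ≈-sym (distribˡ κ _ _) ⟩
        κ * (Z (p ++ g ∷ f ∷ q) + Zinsert tf p q)
          ≈⟨ *-congˡ (≈-sym (Z-firstDescent p f g q adm s f≻g)) ⟩
        κ * Z (p ++ f ∷ g ∷ q) ∎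
        where
        tf = descentTerms f g
        swap = ↭-swapAt p f g q
        drop₁ = ⊆-dropAt p f (g ∷ q)
        drop₂ = ⊆-dropSecond p f g q

    Z-prependColumn : ∀ a x → Admissible ((a , L0) ∷ x) → Z ((a , L0) ∷ x) ≈ β * Z x
    Z-prependColumn a x adm =
      Z-transfer (k ∷_) β (↭.prep k) (refl ∷_) sorted-case (λ p → Z-descent (k ∷ p)) x
        (admissible-⊆ (k ∷ʳ ⊆-refl) adm) adm
      where
      k = (a , L0)
      sorted-case : ∀ y → Sorted y → Z (k ∷ y) ≈ β * Z y
      sorted-case y s = begin
        Z (k ∷ y)
          ≡⟨ Z-sorted (k ∷ y) (All.universal (λ _ → refl) y ∷ s) ⟩
        pow α (countB (freeRow unmarked) y) * (β * pow β (countB (freeColumn unmarked) y))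
          ≈⟨ *-Props.x∙yz≈y∙xz _ β _ ⟩
        β * (pow α (countB (freeRow unmarked) y) * pow β (countB (freeColumn unmarked) y))
          ≡⟨ cong (β *_) (sym (Z-sorted y s)) ⟩
        β * Z y ∎

    Z-appendRow : ∀ a x → Admissible (x ++ [ (a , L2) ]) → Z (x ++ [ (a , L2) ]) ≈ α * Z x
    Z-appendRow a x adm =
      Z-transfer (_++ [ r ]) α (↭.++⁺ʳ [ r ]) (λ τ → ++⁺ τ ⊆-refl) sorted-case relation x
        (subst Admissible (List.++-identityʳ x) (admissible-⊆ (⊆-dropAt x r []) adm)) adm
      where
      r = (a , L2)
      ≯r : ∀ e → (e ≻ r) ≡ false
      ≯r (_ , L0) = refl
      ≯r (_ , L1) = refl
      ≯r (_ , L2) = refl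
      sorted-case : ∀ y → Sorted y → Z (y ++ [ r ]) ≈ α * Z y
      sorted-case y s = begin
        Z (y ++ [ r ])
          ≡⟨ Z-sorted (y ++ [ r ]) (AllPairs.++⁺ s ([] ∷ []) (All.universal (λ e → ≯r e ∷ []) y)) ⟩
        Zfill (y ++ [ r ]) unmarked []
          ≡⟨ Zfill-↭ (↭.↭-sym (↭.∷↭∷ʳ r y)) unmarked [] ⟩
        (α * pow α (countB (freeRow unmarked) y)) * pow β (countB (freeColumn unmarked) y)
          ≈⟨ *-assoc α _ _ ⟩
        α * Zfill y unmarked []
          ≡⟨ cong (α *_) (sym (Z-sorted y s)) ⟩
        α * Z y ∎
      relation : ∀ p f g q → Admissible ((p ++ f ∷ g ∷ q) ++ [ r ]) → (f ≻ g) ≡ true →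
        Z ((p ++ f ∷ g ∷ q) ++ [ r ]) ≈
          Z ((p ++ g ∷ f ∷ q) ++ [ r ]) + lincomb (descentTerms f g) (λ d → Z ((p ++ d ∷ q) ++ [ r ]))
      relation p f g q adm f≻g = ≈-trans (Z-assoc p (f ∷ g ∷ q) [ r ])
        (≈-trans (Z-descent p f g (q ++ [ r ]) (subst Admissible (List.++-assoc p (f ∷ g ∷ q) [ r ]) adm) f≻g)
          (≈-sym (+-cong (Z-assoc p (g ∷ f ∷ q) [ r ]) (lincomb-cong (descentTerms f g) (λ d → Z-assoc p (d ∷ q) [ r ])))))

    descentTerms-relabel : ∀ π → (∀ ℓ → z (π ℓ) ≡ z ℓ) → ∀ f g (G : Labelled → C) →
      lincomb (descentTerms (relabel π f) (relabel π g)) G ≈ lincomb (descentTerms f g) (λ d → G (relabel π d))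
    descentTerms-relabel π zπ (a , L2) (b , L1) G rewrite zπ b = ≈-refl
    descentTerms-relabel π zπ (a , L1) (b , L0) G rewrite zπ a = ≈-refl
    descentTerms-relabel π zπ (a , L2) (b , L0) G = ≈-refl
    descentTerms-relabel π zπ (a , L0) (b , _)  G = ≈-refl
    descentTerms-relabel π zπ (a , L1) (b , L1) G = ≈-refl
    descentTerms-relabel π zπ (a , L1) (b , L2) G = ≈-refl
    descentTerms-relabel π zπ (a , L2) (b , L2) G = ≈-refl

    Z-relabel : ∀ π → (∀ ℓ → z (π ℓ) ≡ z ℓ) → ∀ x → Admissible x → Admissible (map (relabel π) x) →
      Z (map (relabel π) x) ≈ Z x
    Z-relabel π zπ x adm admπ =
      ≈-trans (Z-transfer (map R) 1# (↭.map⁺ R) (Sublist.map⁺ R) sorted-case relation x adm admπ) (*-identityˡ _)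
      where
      R = relabel π
      sorted-case : ∀ y → Sorted y → Z (map R y) ≈ 1# * Z y
      sorted-case y s = begin
        Z (map R y)                  ≡⟨ Z-sorted (map R y) (sorted-relabel π y s) ⟩
        Zfill (map R y) unmarked []  ≡⟨ cong₂ (λ m n → pow α m * pow β n) (countB-map _ R y) (countB-map _ R y) ⟩
        Zfill y unmarked []          ≡⟨ sym (Z-sorted y s) ⟩
        Z y                          ≈⟨ ≈-sym (*-identityˡ _) ⟩
        1# * Z y                     ∎
      relation : ∀ p f g q → Admissible (map R (p ++ f ∷ g ∷ q)) → (f ≻ g) ≡ true →
        Z (map R (p ++ f ∷ g ∷ q)) ≈ Z (map R (p ++ g ∷ f ∷ q)) + lincomb (descentTerms f g) (λ d → Z (map R (p ++ d ∷ q)))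
      relation p f g q adm f≻g = begin
        Z (map R (p ++ f ∷ g ∷ q))
          ≡⟨ cong Z (List.map-++ R p (f ∷ g ∷ q)) ⟩
        Z (map R p ++ R f ∷ R g ∷ map R q)
          ≈⟨ Z-descent (map R p) (R f) (R g) (map R q) (subst Admissible (List.map-++ R p (f ∷ g ∷ q)) adm) f≻g ⟩
        Z (map R p ++ R g ∷ R f ∷ map R q) + Zinsert (descentTerms (R f) (R g)) (map R p) (map R q)
          ≈⟨ +-congˡ (descentTerms-relabel π zπ f g (λ d → Z (map R p ++ d ∷ map R q))) ⟩
        Z (map R p ++ R g ∷ R f ∷ map R q) + lincomb (descentTerms f g) (λ d → Z (map R p ++ R d ∷ map R q))
          ≈⟨ ≈-sym (+-cong (reflexive (cong Z (List.map-++ R p (g ∷ f ∷ q))))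
                   (lincomb-cong (descentTerms f g) (λ d → reflexive (cong Z (List.map-++ R p (d ∷ q)))))) ⟩
        Z (map R (p ++ g ∷ f ∷ q)) + lincomb (descentTerms f g) (λ d → Z (map R (p ++ d ∷ q))) ∎

    z-transpose : ∀ a b → OffDiagonal a → OffDiagonal b → ∀ ℓ → z (transpose a b ℓ) ≡ z ℓ
    z-transpose a b a∉O b∉O ℓ with ℓ ≡ᵇ a in ℓ≈a
    ... | true rewrite ≡ᵇ-true⇒≡ ℓ a ℓ≈a = trans (zOf-∉ O zs b b∉O) (sym (zOf-∉ O zs a a∉O))
    ... | false with ℓ ≡ᵇ b in ℓ≈b
    ...   | true rewrite ≡ᵇ-true⇒≡ ℓ b ℓ≈b = trans (zOf-∉ O zs a a∉O) (sym (zOf-∉ O zs b b∉O))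
    ...   | false = refl

    transpose-rows : ∀ u a b y → Admissible (u ++ (a , L2) ∷ (b , L2) ∷ y) →
      (∀ ℓ → z (transpose a b ℓ) ≡ z ℓ) ×
      map (relabel (transpose a b)) u ≡ u × map (relabel (transpose a b)) y ≡ y
    transpose-rows u a b y adm =
      z-transpose a b (offDiagonal (a , L2) (λ ()) ca) (offDiagonal (b , L2) (λ ()) cb) ,
      transpose-fixes a b u (DistinctAt.f∉p d) (DistinctAt.g∉p d) ,
      transpose-fixes a b y (DistinctAt.f∉q d) (DistinctAt.g∉q d)
      where
      d = distinctAt u (a , L2) (b , L2) y (proj₁ adm)
      ca = proj₁ (compatible-middle u (a , L2) (b , L2) y adm)
      cb = proj₂ (compatible-middle u (a , L2) (b , L2) y adm)

    Z-swapRows : ∀ u a b y → Admissible (u ++ (a , L2) ∷ (b , L2) ∷ y) →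
      Z (u ++ (a , L2) ∷ (b , L2) ∷ y) ≈ Z (u ++ (b , L2) ∷ (a , L2) ∷ y)
    Z-swapRows u a b y adm with transpose-rows u a b y adm
    ... | zπ , u-fixed , y-fixed = ≈-sym (≈-trans (reflexive (cong Z (sym renamed)))
      (Z-relabel (transpose a b) zπ _ adm (subst Admissible (sym renamed) (admissible-↭ (↭-swapAt u _ _ y) adm))))
      where
      renamed : map (relabel (transpose a b)) (u ++ (a , L2) ∷ (b , L2) ∷ y) ≡ u ++ (b , L2) ∷ (a , L2) ∷ y
      renamed rewrite List.map-++ (relabel (transpose a b)) u ((a , L2) ∷ (b , L2) ∷ y)
                    | u-fixed | y-fixed | transpose-a a b | transpose-b a b = refl

    Z-renameRow : ∀ u a b y → Admissible (u ++ (a , L2) ∷ (b , L2) ∷ y) →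
      Z (u ++ (a , L2) ∷ y) ≈ Z (u ++ (b , L2) ∷ y)
    Z-renameRow u a b y adm with transpose-rows u a b y adm
    ... | zπ , u-fixed , y-fixed = ≈-sym (≈-trans (reflexive (cong Z (sym renamed)))
      (Z-relabel (transpose a b) zπ _ (admissible-⊆ (⊆-dropSecond u _ _ y) adm)
        (subst Admissible (sym renamed) (admissible-⊆ (⊆-dropAt u _ _) adm))))
      where
      renamed : map (relabel (transpose a b)) (u ++ (a , L2) ∷ y) ≡ u ++ (b , L2) ∷ y
      renamed rewrite List.map-++ (relabel (transpose a b)) u ((a , L2) ∷ y)
                    | u-fixed | y-fixed | transpose-a a b = refl

    Z-passColumn : ∀ u a q y → Admissible (u ++ (a , L2) ∷ (q , L0) ∷ y) → Admissible (u ++ (a , L2) ∷ (q , L2) ∷ y) →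
      Z (u ++ (a , L2) ∷ (q , L0) ∷ y) ≈ Z (u ++ (q , L0) ∷ (a , L2) ∷ y) + (Z (u ++ (q , L2) ∷ y) + Z (u ++ (q , L0) ∷ y))
    Z-passColumn u a q y adm-k adm-r′ = ≈-trans (Z-descent u (a , L2) (q , L0) y adm-k refl)
      (+-congˡ (+-cong (≈-trans (*-identityˡ _) (Z-renameRow u a q y adm-r′)) (≈-trans (+-identityʳ _) (*-identityˡ _))))

    zDiag : Template → C
    zDiag tm = ∑ (ones tm) z

    zLetters : List Labelled → C
    zLetters ds = ∑ ds (λ e → z (label e))

    -- Passing a letter 1 costs its weight z, passing a 0 or a 2 costs 1 (Z-passColumn, Z-swapRows).
    Z-pushRow : ∀ tm u a → All (λ y → Admissible (u ++ (a , L2) ∷ y)) (completions tm) →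
      ∑ (completions tm) (λ y → Z (u ++ (a , L2) ∷ y)) ≈
        ∑ (completions tm) (λ y → Z (u ++ y ++ [ (a , L2) ])) +
        (natS (holes tm) + zDiag tm) * ∑ (completions tm) (λ y → Z (u ++ y))
    Z-pushRow-∷ : ∀ tm u d a → All (λ y → Admissible (u ++ d ∷ (a , L2) ∷ y)) (completions tm) →
      ∑ (completions tm) (λ y → Z (u ++ d ∷ (a , L2) ∷ y)) ≈
        ∑ (completions tm) (λ y → Z (u ++ d ∷ y ++ [ (a , L2) ])) +
        (natS (holes tm) + zDiag tm) * ∑ (completions tm) (λ y → Z (u ++ d ∷ y))

    Z-pushRow [] u a _ =
      ≈-sym (≈-trans (+-congˡ (≈-trans (*-congʳ (+-identityˡ 0#)) (zeroˡ _))) (+-identityʳ _))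
    Z-pushRow ((q , true) ∷ tm) u a adm = begin
      ∑ (map (d ∷_) Y) (λ y → Z (u ++ r ∷ y))
        ≡⟨ ∑-map (d ∷_) Y _ ⟩
      ∑ Y (λ y → Z (u ++ r ∷ d ∷ y))
        ≈⟨ ∑-congᴬ (All.map (λ adm-y → ≈-trans (Z-descent u r d _ adm-y refl) (+-congˡ (+-identityʳ _))) adm′) ⟩
      ∑ Y (λ y → Z (u ++ d ∷ r ∷ y) + z q * Z (u ++ d ∷ y))
        ≈⟨ ≈-trans (∑-+ Y _ _) (+-congˡ (∑-*ˡ Y (z q) _)) ⟩
      ∑ Y (λ y → Z (u ++ d ∷ r ∷ y)) + z q * Yd
        ≈⟨ +-congʳ (Z-pushRow-∷ tm u d a (All.map (admissible-↭ (↭-swapAt u r d _)) adm′)) ⟩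
      (Xd + (natS (holes tm) + zDiag tm) * Yd) + z q * Yd
        ≈⟨ solve 5 (λ x n t y w → (x :+ (n :+ t) :* y) :+ w :* y := x :+ (n :+ (w :+ t)) :* y) ≈-refl
             Xd (natS (holes tm)) (zDiag tm) Yd (z q) ⟩
      Xd + (natS (holes tm) + (z q + zDiag tm)) * Yd
        ≡⟨ sym (cong₂ (λ X Y → X + (natS (holes tm) + (z q + zDiag tm)) * Y) (∑-map (d ∷_) Y _) (∑-map (d ∷_) Y _)) ⟩
      ∑ (map (d ∷_) Y) (λ y → Z (u ++ y ++ [ r ])) +
        (natS (holes tm) + (z q + zDiag tm)) * ∑ (map (d ∷_) Y) (λ y → Z (u ++ y)) ∎
      where
      Y = completions tm
      r = (a , L2)
      d = (q , L1)
      adm′ = All.map⁻ adm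
      Xd = ∑ Y (λ y → Z (u ++ d ∷ y ++ [ r ]))
      Yd = ∑ Y (λ y → Z (u ++ d ∷ y))
    Z-pushRow ((q , false) ∷ tm) u a adm = begin
      ∑ (completions ((q , false) ∷ tm)) (λ y → Z (u ++ r ∷ y))
        ≈⟨ ∑-completions-hole q tm _ ⟩
      ∑ Y (λ y → Z (u ++ r ∷ k ∷ y)) + ∑ Y (λ y → Z (u ++ r ∷ r′ ∷ y))
        ≈⟨ +-cong (≈-trans (∑-congᴬ (All.zipWith (λ (adm-k , adm-r′) → Z-passColumn u a q _ adm-k adm-r′) (adm-k , adm-r′)))
                           (≈-trans (∑-+ Y _ _) (+-congˡ (∑-+ Y _ _))))
                  (∑-congᴬ (All.map (Z-swapRows u a q _) adm-r′)) ⟩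
      (∑ Y (λ y → Z (u ++ k ∷ r ∷ y)) + (Y₂ + Y₀)) + ∑ Y (λ y → Z (u ++ r′ ∷ r ∷ y))
        ≈⟨ +-cong (+-congʳ (Z-pushRow-∷ tm u k a (All.map (admissible-↭ (↭-swapAt u r k _)) adm-k)))
                  (Z-pushRow-∷ tm u r′ a (All.map (admissible-↭ (↭-swapAt u r r′ _)) adm-r′)) ⟩
      ((X₀ + K * Y₀) + (Y₂ + Y₀)) + (X₂ + K * Y₂)
        ≈⟨ solve 6 (λ x₀ x₂ y₀ y₂ n t → ((x₀ :+ (n :+ t) :* y₀) :+ (y₂ :+ y₀)) :+ (x₂ :+ (n :+ t) :* y₂)
                   := (x₀ :+ x₂) :+ ((con 1 :+ n) :+ t) :* (y₀ :+ y₂)) ≈-refl X₀ X₂ Y₀ Y₂ (natS (holes tm)) (zDiag tm) ⟩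
      (X₀ + X₂) + ((1# + natS (holes tm)) + zDiag tm) * (Y₀ + Y₂)
        ≈⟨ ≈-sym (+-cong (∑-completions-hole q tm _) (*-congˡ (∑-completions-hole q tm _))) ⟩
      ∑ (completions ((q , false) ∷ tm)) (λ y → Z (u ++ y ++ [ r ])) +
        ((1# + natS (holes tm)) + zDiag tm) * ∑ (completions ((q , false) ∷ tm)) (λ y → Z (u ++ y)) ∎
      where
      Y = completions tm
      r = (a , L2)
      k = (q , L0)
      r′ = (q , L2)
      K = natS (holes tm) + zDiag tm
      adm-k = proj₁ (All-completions-hole q tm adm)
      adm-r′ = proj₂ (All-completions-hole q tm adm)
      X₀ = ∑ Y (λ y → Z (u ++ k ∷ y ++ [ r ]))
      X₂ = ∑ Y (λ y → Z (u ++ r′ ∷ y ++ [ r ]))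
      Y₀ = ∑ Y (λ y → Z (u ++ k ∷ y))
      Y₂ = ∑ Y (λ y → Z (u ++ r′ ∷ y))

    Z-pushRow-∷ tm u d a adm =
      ≈-trans (∑-cong Y (λ y → ≈-sym (Z-assoc u [ d ] ((a , L2) ∷ y))))
        (≈-trans (Z-pushRow tm (u ++ [ d ]) a
                   (All.map (λ {y} → subst Admissible (sym (List.++-assoc u [ d ] ((a , L2) ∷ y)))) adm))
          (+-cong (∑-cong Y (λ y → Z-assoc u [ d ] (y ++ [ (a , L2) ])))
                  (*-congˡ (∑-cong Y (λ y → Z-assoc u [ d ] y)))))
      where Y = completions tm

    Z-pullColumn : ∀ ds u a y → All (λ e → letter e ≡ L1) ds → Admissible (u ++ ds ++ (a , L0) ∷ y) →
      Z (u ++ ds ++ (a , L0) ∷ y) ≈ Z (u ++ (a , L0) ∷ ds ++ y) + zLetters ds * Z (u ++ ds ++ y)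
    Z-pullColumn [] u a y [] _ = ≈-sym (≈-trans (+-congˡ (zeroˡ _)) (+-identityʳ _))
    Z-pullColumn ((ℓ , .L1) ∷ ds) u a y (refl ∷ ones) adm = begin
      Z (u ++ d ∷ ds ++ k ∷ y)
        ≈⟨ ≈-sym (Z-assoc u [ d ] (ds ++ k ∷ y)) ⟩
      Z ((u ++ [ d ]) ++ ds ++ k ∷ y)
        ≈⟨ Z-pullColumn ds (u ++ [ d ]) a y ones (subst Admissible (sym (List.++-assoc u [ d ] _)) adm) ⟩
      Z ((u ++ [ d ]) ++ k ∷ ds ++ y) + zLetters ds * Z ((u ++ [ d ]) ++ ds ++ y)
        ≈⟨ +-cong (Z-assoc u [ d ] (k ∷ ds ++ y)) (*-congˡ (Z-assoc u [ d ] (ds ++ y))) ⟩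
      Z (u ++ d ∷ k ∷ ds ++ y) + zLetters ds * Z (u ++ d ∷ ds ++ y)
        ≈⟨ +-congʳ (≈-trans (Z-descent u d k (ds ++ y) adm-dk refl) (+-congˡ (+-identityʳ _))) ⟩
      (Z (u ++ k ∷ d ∷ ds ++ y) + z ℓ * Z (u ++ d ∷ ds ++ y)) + zLetters ds * Z (u ++ d ∷ ds ++ y)
        ≈⟨ solve 4 (λ a z b w → (a :+ z :* b) :+ w :* b := a :+ (z :+ w) :* b) ≈-refl
             (Z (u ++ k ∷ d ∷ ds ++ y)) (z ℓ) (Z (u ++ d ∷ ds ++ y)) (zLetters ds) ⟩
      Z (u ++ k ∷ d ∷ ds ++ y) + (z ℓ + zLetters ds) * Z (u ++ d ∷ ds ++ y) ∎
      where
      d = (ℓ , L1)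
      k = (a , L0)
      adm-dk = admissible-↭ (++⁺ˡ u (↭.prep d (shift k ds y))) adm

    Z-ones : ∀ ds → All (λ e → letter e ≡ L1) ds → Z ds ≈ 1#
    Z-ones ds ones = begin
      Z ds
        ≡⟨ Z-sorted ds (ones-sorted ds ones) ⟩
      pow α (countB (freeRow unmarked) ds) * pow β (countB (freeColumn unmarked) ds)
        ≡⟨ cong₂ (λ m n → pow α m * pow β n) (no-rows ds ones) (no-columns ds ones) ⟩
      1# * 1#
        ≈⟨ *-identityˡ 1# ⟩
      1# ∎
      where
      ones-sorted : ∀ ds → All (λ e → letter e ≡ L1) ds → Sorted ds
      ones-sorted []             []            = []
      ones-sorted ((_ , .L1) ∷ ds) (refl ∷ ones) = All.map (λ { refl → refl }) ones ∷ ones-sorted ds ones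
      no-rows : ∀ ds → All (λ e → letter e ≡ L1) ds → countB (freeRow unmarked) ds ≡ 0
      no-rows []               []            = refl
      no-rows ((_ , .L1) ∷ ds) (refl ∷ ones) = no-rows ds ones
      no-columns : ∀ ds → All (λ e → letter e ≡ L1) ds → countB (freeColumn unmarked) ds ≡ 0
      no-columns []               []            = refl
      no-columns ((_ , .L1) ∷ ds) (refl ∷ ones) = no-columns ds ones

    Z-completions : ∀ tm ds → All (λ e → letter e ≡ L1) ds → All (λ y → Admissible (ds ++ y)) (completions tm) →
      ∑ (completions tm) (λ y → Z (ds ++ y)) ≈ rising (α + β + (zLetters ds + zDiag tm)) (holes tm)
    Z-completions [] ds ones _ =
      ≈-trans (+-identityʳ _) (≈-trans (reflexive (cong Z (List.++-identityʳ ds))) (Z-ones ds ones))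
    Z-completions ((q , true) ∷ tm) ds ones adm = begin
      ∑ (map (d ∷_) Y) (λ y → Z (ds ++ y))
        ≡⟨ ∑-map (d ∷_) Y _ ⟩
      ∑ Y (λ y → Z (ds ++ d ∷ y))
        ≈⟨ ∑-cong Y (λ y → ≈-sym (Z-assoc ds [ d ] y)) ⟩
      ∑ Y (λ y → Z ((ds ++ [ d ]) ++ y))
        ≈⟨ Z-completions tm (ds ++ [ d ]) (All.++⁺ ones (refl ∷ []))
             (All.map (λ {y} → subst Admissible (sym (List.++-assoc ds [ d ] y))) (All.map⁻ adm)) ⟩
      rising (α + β + (zLetters (ds ++ [ d ]) + zDiag tm)) (holes tm)
        ≈⟨ rising-cong (holes tm) (+-congˡ (≈-trans (+-congʳ (≈-trans (∑-++ ds [ d ] _) (+-congˡ (+-identityʳ _))))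
                                                    (+-assoc _ _ _))) ⟩
      rising (α + β + (zLetters ds + (z q + zDiag tm))) (holes tm) ∎
      where
      Y = completions tm
      d = (q , L1)
    Z-completions ((p , false) ∷ tm) ds ones adm = begin
      ∑ (completions ((p , false) ∷ tm)) (λ y → Z (ds ++ y))
        ≈⟨ ∑-completions-hole p tm _ ⟩
      ∑ Y (λ y → Z (ds ++ k ∷ y)) + ∑ Y (λ y → Z (ds ++ r ∷ y))
        ≈⟨ +-cong (≈-trans (∑-congᴬ (All.map column adm-k)) (∑-*ˡ Y _ _))
                  (≈-trans (Z-pushRow tm ds p adm-r) (+-congʳ (≈-trans (∑-congᴬ (All.map row adm-r)) (∑-*ˡ Y α _)))) ⟩
      (β + zLetters ds) * Yt + (α * Yt + (natS (holes tm) + zDiag tm) * Yt)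
        ≈⟨ solve 6 (λ b l y a n t → (b :+ l) :* y :+ (a :* y :+ (n :+ t) :* y) := ((a :+ b :+ (l :+ t)) :+ n) :* y)
             ≈-refl β (zLetters ds) Yt α (natS (holes tm)) (zDiag tm) ⟩
      (K + natS (holes tm)) * Yt
        ≈⟨ *-congˡ (Z-completions tm ds ones (All.map (admissible-⊆ (⊆-dropAt ds k _)) adm-k)) ⟩
      (K + natS (holes tm)) * rising K (holes tm)
        ≈⟨ *-comm _ _ ⟩
      rising K (holes tm) * (K + natS (holes tm)) ∎
      where
      Y = completions tm
      k = (p , L0)
      r = (p , L2)
      K = α + β + (zLetters ds + zDiag tm)
      Yt = ∑ Y (λ y → Z (ds ++ y))
      adm-k = proj₁ (All-completions-hole p tm adm)
      adm-r = proj₂ (All-completions-hole p tm adm)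
      column : ∀ {y} → Admissible (ds ++ k ∷ y) → Z (ds ++ k ∷ y) ≈ (β + zLetters ds) * Z (ds ++ y)
      column {y} adm-y = ≈-trans (Z-pullColumn ds [] p y ones adm-y)
        (≈-trans (+-congʳ (Z-prependColumn p (ds ++ y) (admissible-↭ (shift k ds y) adm-y))) (≈-sym (distribʳ _ _ _)))
      row : ∀ {y} → Admissible (ds ++ r ∷ y) → Z (ds ++ y ++ [ r ]) ≈ α * Z (ds ++ y)
      row {y} adm-y = ≈-trans (≈-sym (Z-assoc ds y [ r ]))
        (Z-appendRow p (ds ++ y)
          (subst Admissible (sym (List.++-assoc ds y [ r ])) (admissible-↭ (++⁺ˡ ds (↭.∷↭∷ʳ r y)) adm-y)))

  select : List ℕ → List C → (ℕ → Bool) → C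
  select (o ∷ os) (z ∷ zs) B = (if B o then z else 1#) * select os zs B
  select _        _        _ = 1#

  zMonomial-step : ∀ os zs (B : ℕ → Bool) (n : ℕ → ℕ) →
    zMonomial zs (map (λ o → if B o then suc (n o) else n o) os) ≈ select os zs B * zMonomial zs (map n os)
  zMonomial-step []       zs       B n = ≈-sym (*-identityˡ _)
  zMonomial-step (o ∷ os) []       B n = ≈-sym (*-identityˡ _)
  zMonomial-step (o ∷ os) (z ∷ zs) B n with B o
  ... | true = ≈-trans (*-congˡ (zMonomial-step os zs B n))
    (solve 4 (λ z p s m → (z :* p) :* (s :* m) := (z :* s) :* (p :* m)) ≈-refl z (pow z (n o)) (select os zs B) _)
  ... | false = ≈-trans (*-congˡ (zMonomial-step os zs B n))
    (≈-trans (*-Props.x∙yz≈y∙xz (pow z (n o)) (select os zs B) _) (*-congʳ (≈-sym (*-identityˡ _))))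

  select-none : ∀ os zs → select os zs (λ _ → false) ≈ 1#
  select-none []       []       = ≈-refl
  select-none []       (z ∷ zs) = ≈-refl
  select-none (o ∷ os) []       = ≈-refl
  select-none (o ∷ os) (z ∷ zs) = ≈-trans (*-identityˡ _) (select-none os zs)

  select-inStrip : ∀ os zs t → select os zs (λ o → inStrip o t) ≈ zTile os zs t
  select-inStrip []       []       t = ≈-refl
  select-inStrip []       (z ∷ zs) t = ≈-refl
  select-inStrip (o ∷ os) []       t = ≈-refl
  select-inStrip (o ∷ os) (z ∷ zs) t with inStrip o t
  ... | true  = *-congˡ (select-inStrip os zs t)
  ... | false = ≈-trans (*-identityˡ _) (select-inStrip os zs t)

  select-arrow : ∀ os zs a t → select os zs (λ o → isArrow a ∧ inStrip o t) ≈ (if isArrow a then zTile os zs t else 1#)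
  select-arrow os zs none t = select-none os zs
  select-arrow os zs up   t = select-inStrip os zs t
  select-arrow os zs left t = select-inStrip os zs t

  zMonomial-zeros : ∀ (os : List ℕ) zs → zMonomial zs (map (λ _ → 0) os) ≈ 1#
  zMonomial-zeros []       []       = ≈-refl
  zMonomial-zeros []       (z ∷ zs) = ≈-refl
  zMonomial-zeros (o ∷ os) []       = ≈-refl
  zMonomial-zeros (o ∷ os) (z ∷ zs) = ≈-trans (*-identityˡ _) (zMonomial-zeros os zs)

  zMonomial-arrows : ∀ g os zs ts f →
    zMonomial zs (map (λ o → countB (arrowIn o) (indexed g ts f)) os) ≈ zArrows os zs ts f
  zMonomial-arrows g os zs []       f       = zMonomial-zeros os zs
  zMonomial-arrows g os zs (t ∷ ts) []      = zMonomial-zeros os zs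
  zMonomial-arrows g os zs (t ∷ ts) (a ∷ f) =
    ≈-trans (zMonomial-step os zs (λ o → isArrow a ∧ inStrip o t) (λ o → countB (arrowIn o) (indexed (g ∘ suc) ts f)))
      (*-cong (select-arrow os zs a t) (zMonomial-arrows (g ∘ suc) os zs ts f))

  weight≈fillingWeight : ∀ α β zs w f →
    weight α β zs (w , f) ≈
      Weights.fillingWeight α β (diagonalLabels (labelW w)) zs (labelW w) unmarked (maximalTiling w) f
  weight≈fillingWeight α β zs w f = *-cong (reflexive (cong₂ (λ m n → pow α m * pow β n) rows columns)) diagonals
    where
    ts = maximalTiling w
    rows : frow (w , f) ≡ countB (freeRow (markAll ts f unmarked)) (labelW w)
    rows = countB-congᴬ (All.universal (λ e → cong (λ b → (letter e =ᴸ L2) ∧ not b)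
      (sym (trans (hasLeft-markAll (λ k → k) ts f unmarked (label e)) (∨-identityʳ _)))) (labelW w))
    columns : fcol (w , f) ≡ countB (freeColumn (markAll ts f unmarked)) (labelW w)
    columns = countB-congᴬ (All.universal (λ e → cong (λ b → (letter e =ᴸ L0) ∧ not b)
      (sym (trans (hasUp-markAll (λ k → k) ts f unmarked (label e)) (∨-identityʳ _)))) (labelW w))
    diagonals : zMonomial zs (aStats (w , f)) ≈ zArrows (diagonalLabels (labelW w)) zs ts f
    diagonals = ≈-trans (reflexive (cong (zMonomial zs) (List.map-∘ (filter _ (labelW w)))))
      (zMonomial-arrows (λ k → k) (diagonalLabels (labelW w)) zs ts f)

  Zword : C → C → List C → List Letter → C
  Zword α β zs w = Weights.Z α β (diagonalLabels (labelW w)) zs (labelW w)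

  ∑-RATs-of-shape : ∀ α β zs w →
    ∑ (filter (λ R → isRAT R Data.Bool.≟ true) (map (w ,_) (fillings (length (maximalTiling w))))) (weight α β zs)
      ≈ Zword α β zs w
  ∑-RATs-of-shape α β zs w = begin
    ∑ (filter (λ R → isRAT R Data.Bool.≟ true) (map (w ,_) F)) (weight α β zs)
      ≈⟨ ∑-filter (λ R → isRAT R Data.Bool.≟ true) (map (w ,_) F) (weight α β zs) ⟩
    ∑ (map (w ,_) F) (λ R → when (does (isRAT R Data.Bool.≟ true)) (weight α β zs R))
      ≡⟨ ∑-map (w ,_) F _ ⟩
    ∑ F (λ f → when (does (isRAT (w , f) Data.Bool.≟ true)) (weight α β zs (w , f)))
      ≈⟨ ∑-cong F (λ f → when-cong (trans (does-≟-true (isRAT (w , f)))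
                                         (cong ((length f ≡ᵇ length ts) ∧_) (validPlaced-placed ts f)))
                                  (weight≈fillingWeight α β zs w f)) ⟩
    ∑ F (W.fillingTerm (labelW w) unmarked ts)
      ≈⟨ W.Zfill-fillings (labelW w) ts unmarked ⟩
    W.Zfill (labelW w) unmarked ts
      ≡⟨ cong (W.Zfill (labelW w) unmarked) (maximalTiling≡tiling w) ⟩
    W.Z (labelW w) ∎
    where
    ts = maximalTiling w
    F = fillings (length ts)
    module W = Weights α β (diagonalLabels (labelW w)) zs

  ∑-RATs : ∀ n r α β zs →
    ∑ (RATs n r) (weight α β zs) ≈ ∑ (words n) (λ w → when (countL L1 w ≡ᵇ r) (Zword α β zs w))
  ∑-RATs n r α β zs = ≈-trans (∑-concatMap _ (filter (λ w → countL L1 w Data.Nat.≟ r) (words n)) _)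
    (≈-trans (∑-filter (λ w → countL L1 w Data.Nat.≟ r) (words n) _)
             (∑-cong (words n) (λ w → when-cong refl (∑-RATs-of-shape α β zs w))))

  ∑-zOf : ∀ os zs → DistinctLabels os → length os ≡ length zs → ∑ os (zOf os zs) ≈ sumS zs
  ∑-zOf []       []       _           _   = ≈-refl
  ∑-zOf (o ∷ os) (z ∷ zs) (o∉os ∷ d) len = +-cong z-o
    (≈-trans (reflexive others) (∑-zOf os zs d (ℕ.suc-injective len)))
    where
    z-o : zOf (o ∷ os) (z ∷ zs) o ≈ z
    z-o rewrite ≡ᵇ-refl o | zOf-∉ os zs o (All.map (λ {m} m≉o → trans (≡ᵇ-sym o m) m≉o) o∉os) = *-identityʳ z
    others : ∑ os (zOf (o ∷ os) (z ∷ zs)) ≡ ∑ os (zOf os zs)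
    others = cong sumS (List.map-cong-local
      (All.map (λ {m} m≉o → cong (λ b → if b then z * zOf os zs m else zOf os zs m) m≉o) o∉os))

  ∑-shapes-true : ∀ P (H : List Letter → C) →
    ∑ (map (true ∷_) P) (λ s → ∑ (shapes s) H) ≡ ∑ P (λ s → ∑ (shapes s) (λ w → H (L1 ∷ w)))
  ∑-shapes-true P H = trans (∑-map (true ∷_) P _) (cong sumS (List.map-cong (λ s → ∑-map (L1 ∷_) (shapes s) H) P))

  ∑-shapes-false : ∀ P (H : List Letter → C) → ∑ (map (false ∷_) P) (λ s → ∑ (shapes s) H) ≈
    ∑ P (λ s → ∑ (shapes s) (λ w → H (L0 ∷ w))) + ∑ P (λ s → ∑ (shapes s) (λ w → H (L2 ∷ w)))
  ∑-shapes-false P H = ≈-trans (reflexive (∑-map (false ∷_) P _))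
    (≈-trans (∑-cong P (λ s → ≈-trans (∑-++ (map (L0 ∷_) (shapes s)) _ H)
                                      (reflexive (cong₂ _+_ (∑-map (L0 ∷_) (shapes s) H) (∑-map (L2 ∷_) (shapes s) H)))))
             (∑-+ P _ _))

  ∑-words : ∀ n r (H : List Letter → C) →
    ∑ (words n) (λ w → when (countL L1 w ≡ᵇ r) (H w)) ≈ ∑ (patterns n r) (λ s → ∑ (shapes s) H)
  ∑-words zero    zero    H = ≈-sym (+-identityʳ _)
  ∑-words zero    (suc r) H = +-identityʳ 0#
  ∑-words (suc n) zero    H = begin
    ∑ (words (suc n)) (λ w → when (countL L1 w ≡ᵇ 0) (H w))
      ≈⟨ ∑-triple (L0 ∷_) (L1 ∷_) (L2 ∷_) (words n) _ ⟩
    ∑ (words n) (λ w → when (countL L1 w ≡ᵇ 0) (H (L0 ∷ w))) +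
      (∑ (words n) (λ _ → 0#) + ∑ (words n) (λ w → when (countL L1 w ≡ᵇ 0) (H (L2 ∷ w))))
      ≈⟨ +-cong (∑-words n zero _) (≈-trans (+-congʳ (∑-0 (words n))) (≈-trans (+-identityˡ _) (∑-words n zero _))) ⟩
    ∑ (patterns n zero) (λ s → ∑ (shapes s) (λ w → H (L0 ∷ w))) + ∑ (patterns n zero) (λ s → ∑ (shapes s) (λ w → H (L2 ∷ w)))
      ≈⟨ ≈-sym (∑-shapes-false (patterns n zero) H) ⟩
    ∑ (patterns (suc n) zero) (λ s → ∑ (shapes s) H) ∎
  ∑-words (suc n) (suc r) H = begin
    ∑ (words (suc n)) (λ w → when (countL L1 w ≡ᵇ suc r) (H w))
      ≈⟨ ∑-triple (L0 ∷_) (L1 ∷_) (L2 ∷_) (words n) _ ⟩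
    ∑ (words n) (λ w → when (countL L1 w ≡ᵇ suc r) (H (L0 ∷ w))) +
      (∑ (words n) (λ w → when (countL L1 w ≡ᵇ r) (H (L1 ∷ w))) +
       ∑ (words n) (λ w → when (countL L1 w ≡ᵇ suc r) (H (L2 ∷ w))))
      ≈⟨ +-cong (∑-words n (suc r) _) (+-cong (∑-words n r _) (∑-words n (suc r) _)) ⟩
    Σ₀ + (Σ₁ + Σ₂)
      ≈⟨ +-Props.x∙yz≈y∙xz Σ₀ Σ₁ Σ₂ ⟩
    Σ₁ + (Σ₀ + Σ₂)
      ≈⟨ ≈-sym (+-cong (reflexive (∑-shapes-true (patterns n r) H)) (∑-shapes-false (patterns n (suc r)) H)) ⟩
    ∑ (map (true ∷_) (patterns n r)) (λ s → ∑ (shapes s) H) + ∑ (map (false ∷_) (patterns n (suc r))) (λ s → ∑ (shapes s) H)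
      ≈⟨ ≈-sym (∑-++ (map (true ∷_) (patterns n r)) _ _) ⟩
    ∑ (patterns (suc n) (suc r)) (λ s → ∑ (shapes s) H) ∎
    where
    Σ₀ = ∑ (patterns n (suc r)) (λ s → ∑ (shapes s) (λ w → H (L0 ∷ w)))
    Σ₁ = ∑ (patterns n r) (λ s → ∑ (shapes s) (λ w → H (L1 ∷ w)))
    Σ₂ = ∑ (patterns n (suc r)) (λ s → ∑ (shapes s) (λ w → H (L2 ∷ w)))

  ∑-shape : ∀ α β zs s → length zs ≡ trues s →
    ∑ (shapes s) (Zword α β zs) ≈ rising (α + β + sumS zs) (length s ∸ trues s)
  ∑-shape α β zs s len = begin
    ∑ (shapes s) (λ w → Zw (labelW w))
      ≡⟨ sym (∑-map labelW (shapes s) Zw) ⟩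
    ∑ (map labelW (shapes s)) Zw
      ≡⟨ cong (λ L → ∑ L Zw) (labelWith-shapes suc s) ⟩
    ∑ (completions tm) Zw
      ≈⟨ ∑-congᴬ (All.map (λ {y} O≡ → reflexive (cong (λ O′ → Weights.Z α β O′ zs y) O≡)) (completions-diagonal tm)) ⟩
    ∑ (completions tm) W.Z
      ≈⟨ W.Z-completions tm [] [] admissible ⟩
    rising (α + β + (0# + W.zDiag tm)) (holes tm)
      ≈⟨ rising-cong (holes tm) (+-congˡ (≈-trans (+-identityˡ _)
           (∑-zOf (ones tm) zs (ones-distinct tm distinct) (trans (length-ones-template suc s) (sym len))))) ⟩
    rising (α + β + sumS zs) (holes tm)
      ≡⟨ cong (rising _) (holes-template suc s) ⟩
    rising (α + β + sumS zs) (length s ∸ trues s) ∎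
    where
    Zw : List Labelled → C
    Zw y = Weights.Z α β (diagonalLabels y) zs y
    tm = template suc s
    module W = Weights α β (ones tm) zs
    distinct = template-distinct suc s≤s s
    admissible : All W.Admissible (completions tm)
    admissible = All.zipWith (λ (labels , letters) → AllPairs.map⁻ (subst DistinctLabels (sym labels) distinct) , letters)
      (completions-labels tm , completions-letters tm (holes-off-ones tm distinct))

theorem4p10 : {c ℓ : Level} (S : CommutativeSemiring c ℓ) (n r : ℕ) → r ≤ n →
    (α β : CommutativeSemiring.Carrier S) (z : Vec (CommutativeSemiring.Carrier S) r) →
    CommutativeSemiring._≈_ S (Gen.LHS S n r α β z) (Gen.RHS S n r α β z)
theorem4p10 S n r _ α β z = begin
  ∑ (RATs n r) (weight α β zs)
    ≈⟨ ∑-RATs n r α β zs ⟩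
  ∑ (words n) (λ w → when (countL L1 w ≡ᵇ r) (Zword α β zs w))
    ≈⟨ ∑-words n r (Zword α β zs) ⟩
  ∑ (patterns n r) (λ s → ∑ (shapes s) (Zword α β zs))
    ≈⟨ ∑-const (patterns n r) (rising K (n ∸ r)) (All.map (λ {s} (length≡n , trues≡r) → ≈-trans
         (∑-shape α β zs s (trans (length-toList z) (sym trues≡r)))
         (reflexive (cong (rising K) (cong₂ _∸_ length≡n trues≡r)))) (patterns-shape n r)) ⟩
  natS (length (patterns n r)) * rising K (n ∸ r)
    ≡⟨ cong (λ m → natS m * rising K (n ∸ r)) (length-patterns n r) ⟩
  natS (n C r) * rising K (n ∸ r) ∎
  where
  open CommutativeSemiring S using (_+_; _*_; setoid; reflexive) renaming (trans to ≈-trans)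
  open Gen S
  open WeightedSums S
  open import Relation.Binary.Reasoning.Setoid setoid
  zs = toList z
  K = α + β + sumS zs
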